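{- In the T-system with principal coefficients described in the context, let $\mathbf{k}$ be a stepped surface obtained from $\mathbf{fund}$ by finitely many allowed mutations, and let $y_{(i,j),\mathbf{k}}$ be the coefficient at the vertex $(i,j)$ of the corresponding seed. Suppose $\mathbf{k}(i,j)=k$, $\mathbf{k}(i,j-1)=k+\epsilon_1$, $\mathbf{k}(i,j+1)=k+\epsilon_2$, $\mathbf{k}(i-1,j)=k+\epsilon_3$, $\mathbf{k}(i+1,j)=k+\epsilon_4$ with $\epsilon_\ell\in\{ -1,1\}$. Then \[ y_{(i,j),\mathbf{k}}=\frac{I_{i,j,k-1}\,J_{i,j-1,k}^{[\epsilon_1]_+}\,J_{i,j+1,k}^{[\epsilon_2]_+}}{J_{i,j,k-1}\,I_{i-1,j,k}^{[\epsilon_3]_+}\,I_{i+1,j,k}^{[\epsilon_4]_+}} =\frac{J_{i,j,k+1}\,I_{i-1,j,k}^{[-\epsilon_3]_+}\,I_{i+1,j,k}^{[-\epsilon_4]_+}}{I_{i,j,k+1}\,J_{i,j-1,k}^{[-\epsilon_1]_+}\,J_{i,j+1,k}^{[-\epsilon_2]_+}}, \] where $I_{a,b,m}=\prod_{s=m+1}^{ -(m+1)}c_{a+s,b}$ if $m<0$ and $I_{a,b,m}=1$ if $m\ge0$, and $J_{a,b,m}=1$ if $m<0$ and $J_{a,b,m}=\prod_{s=-m}^{m}c_{a,b+s}$ if $m\ge 0$.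
   Context: Notation: $[x]_+=\max(0,x)$; $\mathbb{Z}^3_{\rm odd}=\{(i,j,k)\in\mathbb{Z}^3\mid i+j+k\equiv 1 \bmod 2\}$. A stepped surface is a function $\mathbf{k}:\mathbb{Z}^2\to\mathbb{Z}$ with $i+j+\mathbf{k}(i,j)$ odd and $|\mathbf{k}(i,j)-\mathbf{k}(i',j')|=1$ whenever $|i-i'|+|j-j'|=1$; $\mathbf{fund}(i,j)=(i+j\bmod 2)-1$. The T-system with principal coefficients is the infinite-rank cluster pattern over the tropical semifield $\mathbb{P}=\operatorname{Trop}(c_{i,j}:(i,j)\in\mathbb{Z}^2)$ (where $\prod c^{a}\oplus\prod c^{b}=\prod c^{\min(a,b)}$) with initial seed: cluster variables $x_{(i,j)}=T_{i,j,\mathbf{fund}(i,j)}$, coefficients $y_{(i,j)}=c_{i,j}$, exchange matrix $b_{(i',j'),(i,j)}=(-1)^{i+j}(\delta_{i',i+1}\delta_{j',j}+\delta_{i',i-1}\delta_{j',j}-\delta_{i',i}\delta_{j',j+1}-\delta_{i',i}\delta_{j',j-1})$ ($b_{uw}>0$ means arrows $u\to w$). Mutation at $v$: $b'_{uw}=-b_{uw}$ if $u=v$ or $w=v$, else $b'_{uw}=b_{uw}+\operatorname{sgn}(b_{uv})[b_{uv}b_{vw}]_+$; $y'_v=y_v^{ -1}$, $y'_w=y_w(y_v^+)^{[b_{vw}]_+}(y_v^-)^{ -[-b_{vw}]_+}$ ($w\neq v$), with $y_v^+=y_v/(y_v\oplus1)$, $y_v^-=1/(y_v\oplus1)$; cluster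 variables mutate by $x'_v=x_v^{ -1}(y_v^+\prod_u x_u^{[b_{uv}]_+}+y_v^-\prod_u x_u^{[-b_{uv}]_+})$. Vertex $(i,j)$ sits at height $\mathbf{fund}(i,j)$ initially. A mutation at $(i,j)$ is allowed only when its four lattice neighbours $(i\pm1,j),(i,j\pm1)$ have a common height $k'\in\{k-1,k+1\}$ where $k$ is the height of $(i,j)$; afterwards the height of $(i,j)$ becomes $k-2$ if $k'=k-1$ and $k+2$ if $k'=k+1$. The heights of all vertices form the stepped surface associated with the seed; the seed reached in this way is determined by the stepped surface. -}

module Defs where

open import Data.Nat using (ℕ; zero; suc; _%_)
import Data.Nat as N
open import Data.Integer using (ℤ; +_; -[1+_]; _+_; _-_; _*_; -_; _⊔_; _⊓_; ∣_∣; 0ℤ; 1ℤ; -1ℤ; _≟_)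
open import Data.Product using (_×_; _,_; proj₁; proj₂)
open import Data.Bool using (Bool; true; false; if_then_else_; _∧_; _∨_)
open import Relation.Nullary.Decidable using (⌊_⌋)
open import Relation.Binary.PropositionalEquality using (_≡_)
open import Data.Sum using (_⊎_)

V : Set
V = ℤ × ℤ

_==ℤ_ : ℤ → ℤ → Bool
a ==ℤ b = ⌊ a ≟ b ⌋

_==V_ : V → V → Bool
(a , b) ==V (a' , b') = (a ==ℤ a') ∧ (b ==ℤ b')

infix 4 _==ℤ_ _==V_ _≈_
infixl 7 _·_ _÷_
infixr 8 _^_
infixl 6 _⊕_

δ : ℤ → ℤ → ℤ
δ a b = if a ==ℤ b then 1ℤ else 0ℤ

pos : ℤ → ℤ
pos x = x ⊔ 0ℤ

sgn : ℤ → ℤ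
sgn (+ zero)    = 0ℤ
sgn (+ suc _)   = 1ℤ
sgn -[1+ _ ]    = -1ℤ

negOnePow : ℤ → ℤ
negOnePow n with ∣ n ∣ % 2
... | zero = 1ℤ
... | suc _ = -1ℤ

-- The tropical semifield Trop(c_{a,b} : (a,b) ∈ ℤ²).
-- An element ∏ c_{a,b}^{e(a,b)} is represented by its exponent
-- function e : ℤ² → ℤ (only finitely supported ones ever occur).

Mono : Set
Mono = V → ℤ

one : Mono
one _ = 0ℤ

c : ℤ → ℤ → Mono
c a b p = δ (proj₁ p) a * δ (proj₂ p) b

_·_ : Mono → Mono → Mono
(f · g) p = f p + g p

inv : Mono → Mono
inv f p = - f p

_÷_ : Mono → Mono → Mono
f ÷ g = f · inv g

_^_ : Mono → ℤ → Mono
(f ^ e) p = e * f p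

_⊕_ : Mono → Mono → Mono
(f ⊕ g) p = f p ⊓ g p

_≈_ : Mono → Mono → Set
f ≈ g = ∀ p → f p ≡ g p

prodFrom : ℤ → ℕ → (ℤ → Mono) → Mono
prodFrom lo zero    f = one
prodFrom lo (suc n) f = f lo · prodFrom (lo + 1ℤ) n f

-- I_{a,b,m} = ∏_{s=m+1}^{-(m+1)} c_{a+s,b} if m < 0, and 1 if m ≥ 0.
-- For m = -(n+1) the range is s = -n , … , n  (2n+1 factors).
I : ℤ → ℤ → ℤ → Mono
I a b (+ _)     = one
I a b -[1+ n ]  = prodFrom (- (+ n)) (suc (n N.+ n)) (λ s → c (a + s) b)

J : ℤ → ℤ → ℤ → Mono
J a b -[1+ _ ]  = one
J a b (+ n)     = prodFrom (- (+ n)) (suc (n N.+ n)) (λ s → c a (b + s))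

-- Y-seeds with heights (the cluster variables are omitted: coefficient
-- mutation does not depend on them).

record Seed : Set where
  field
    height : V → ℤ          -- the stepped surface
    B      : V → V → ℤ
    y      : V → Mono
open Seed public

fund : V → ℤ
fund (i , j) with ∣ i + j ∣ % 2
... | zero  = -1ℤ
... | suc _ = 0ℤ

B₀ : V → V → ℤ
B₀ (i' , j') (i , j) =
  negOnePow (i + j) *
    ( δ i' (i + 1ℤ) * δ j' j + δ i' (i - 1ℤ) * δ j' j
    - δ i' i * δ j' (j + 1ℤ) - δ i' i * δ j' (j - 1ℤ))

initialSeed : Seed
initialSeed = record
  { height = fund
  ; B      = B₀
  ; y      = λ { (i , j) → c i j }
  }

mutB : (V → V → ℤ) → V → V → V → ℤ
mutB b v u w =
  if (u ==V v) ∨ (w ==V v) then - b u w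
  else b u w + sgn (b u v) * pos (b u v * b v w)

yplus : Mono → Mono
yplus f = f ÷ (f ⊕ one)

yminus : Mono → Mono
yminus f = one ÷ (f ⊕ one)

mutY : (V → V → ℤ) → (V → Mono) → V → V → Mono
mutY b yy v w =
  if w ==V v then inv (yy v)
  else yy w · (yplus (yy v) ^ pos (b v w)) · (yminus (yy v) ^ (- pos (- b v w)))

mutH : (V → ℤ) → V → ℤ → V → ℤ
mutH h v d w = if w ==V v then h v + d else h w

mutate : Seed → V → ℤ → Seed
mutate s v d = record
  { height = mutH (height s) v d
  ; B      = mutB (B s) v
  ; y      = mutY (B s) (y s) v
  }

NeighboursAt : Seed → V → ℤ → Set
NeighboursAt s (i , j) k' =
  (height s (i + 1ℤ , j) ≡ k') × (height s (i - 1ℤ , j) ≡ k')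
  × (height s (i , j + 1ℤ) ≡ k') × (height s (i , j - 1ℤ) ≡ k')

data Reachable : Seed → Set where
  init : Reachable initialSeed
  down : ∀ {s} (v : V) → Reachable s →
         NeighboursAt s v (height s v - 1ℤ) →
         Reachable (mutate s v (- (+ 2)))
  up   : ∀ {s} (v : V) → Reachable s →
         NeighboursAt s v (height s v + 1ℤ) →
         Reachable (mutate s v (+ 2))

IsUnit : ℤ → Set
IsUnit ε = (ε ≡ 1ℤ) ⊎ (ε ≡ -1ℤ)

-- A reachable seed is determined by its stepped surface h in closed form: b_{uw} is given by
-- `exchange h` (lattice neighbours are joined according to their height difference, diagonal
-- neighbours according to the heights at the two other corners of their unit square), and y_w is
-- the first expression of the theorem evaluated on the heights of h at w and its four neighbours.
-- Both facts hold for fund and survive every allowed mutation, at a vertex v of height k whose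
-- neighbours all have height k + σ.  For the exchange matrix only the 3 × 3 block around v matters,
-- and there the claim is a finite check.  For the coefficients, one of I_{k+σ}, J_{k+σ} is trivial,
-- so y_v = (J_{k+σ} / I_{k+σ})^σ has these two monomials as y_v^±; multiplying the neighbouring
-- coefficients by them is exactly what moving v to height k + 2σ does to the formula.  The second
-- expression equals the first because I_{k-1} I_{k+1} J_{j-1,k} J_{j+1,k} = J_{k-1} J_{k+1} I_{i-1,k} I_{i+1,k}.

module Submission where

open import Defs
open import Data.Integer using (ℤ; _+_; _-_; 1ℤ; -_)
open import Data.Product using (_×_; _,_)
open import Relation.Binary.PropositionalEquality using (_≡_)

open import Data.Bool using (Bool; true; false; if_then_else_; _∨_)
open import Data.Empty using (⊥; ⊥-elim)
open import Data.Integer as ℤ using (+_; -[1+_]; _*_; _⊓_; _≤_; +≤+; 0ℤ; -1ℤ; ∣_∣)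
open import Data.Integer using () renaming (_+_ to _+ℤ_)
import Data.Integer.Properties as ℤP
open import Data.Integer.Tactic.RingSolver using (solve-∀)
open import Data.List using (List; []; _∷_; all; cartesianProduct)
open import Data.List.Membership.Propositional using (_∈_)
open import Data.List.Membership.Propositional.Properties using (∈-cartesianProduct⁺)
open import Data.List.Relation.Unary.All using (lookup)
open import Data.List.Relation.Unary.All.Properties using (all⁺)
open import Data.List.Relation.Unary.Any using (here; there)
open import Data.Nat as ℕ using (ℕ; zero; suc; _<_; s≤s; z≤n)
import Data.Nat.Properties as ℕP
open import Data.Nat.DivMod using (_%_; [m+n]%n≡m%n; m%n<n)
open import Data.Product using (proj₁; proj₂; curry)
import Data.Product.Properties as ×P
open import Data.Sum using (_⊎_; inj₁; inj₂; swap)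
open import Function using (_∘_)
open import Relation.Binary.Definitions using (DecidableEquality)
open import Relation.Binary.PropositionalEquality
  using (_≢_; refl; sym; trans; cong; cong₂; subst; subst₂; module ≡-Reasoning)
open import Relation.Nullary using (¬_; yes; no)
open import Relation.Nullary.Decidable using (⌊_⌋; toWitness; isYes≗does; dec-true; dec-false)

_≟V_ : DecidableEquality V
_≟V_ = ×P.≡-dec ℤ._≟_ ℤ._≟_

==ℤ-true : ∀ {a b} → a ≡ b → (a ==ℤ b) ≡ true
==ℤ-true {a} {b} a≡b = trans (isYes≗does (a ℤ.≟ b)) (dec-true (a ℤ.≟ b) a≡b)

==ℤ-false : ∀ {a b} → a ≢ b → (a ==ℤ b) ≡ false
==ℤ-false {a} {b} a≢b = trans (isYes≗does (a ℤ.≟ b)) (dec-false (a ℤ.≟ b) a≢b)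

==V-true : ∀ {u v} → u ≡ v → (u ==V v) ≡ true
==V-true {a , b} refl rewrite ==ℤ-true {a} refl | ==ℤ-true {b} refl = refl

==V-false : ∀ {u v} → u ≢ v → (u ==V v) ≡ false
==V-false {a , b} {a' , b'} u≢v with a ℤ.≟ a'
... | no _     = refl
... | yes refl = ==ℤ-false λ b≡b' → u≢v (cong (a ,_) b≡b')

==V-sound : ∀ {u v} → (u ==V v) ≡ true → u ≡ v
==V-sound {u} {v} eq with u ≟V v
... | yes u≡v = u≡v
... | no u≢v with () ← trans (sym eq) (==V-false u≢v)

isOrigin : ℤ → ℤ → Bool
isOrigin a b = (a , b) ==V (0ℤ , 0ℤ)

isOrigin-sound : ∀ {a b} → isOrigin a b ≡ true → a ≡ 0ℤ × b ≡ 0ℤ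
isOrigin-sound o = cong proj₁ (==V-sound o) , cong proj₂ (==V-sound o)

isOrigin-false : ∀ {a b} → ¬ (a ≡ 0ℤ × b ≡ 0ℤ) → isOrigin a b ≡ false
isOrigin-false ¬origin = ==V-false λ eq → ¬origin (cong proj₁ eq , cong proj₂ eq)

+-cancelˡ : ∀ i {a a'} → i + a ≡ i + a' → a ≡ a'
+-cancelˡ i {a} {a'} eq = trans (sym (add-sub i a)) (trans (cong (_- i) eq) (add-sub i a'))
  where add-sub : ∀ i a → (i + a) - i ≡ a
        add-sub = solve-∀

unshift : ∀ {a b} d → a + d ≡ b → a ≡ b - d
unshift {a} d eq = trans (sym (add-sub a d)) (cong (_- d) eq)
  where add-sub : ∀ a d → (a + d) - d ≡ a
        add-sub = solve-∀

≢-by-difference : ∀ {x y} d → y - x ≡ d → d ≢ 0ℤ → y ≢ x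
≢-by-difference {x} d eq d≢0 refl = d≢0 (trans (sym eq) (ℤP.+-inverseʳ x))

private
  succ-diff : ∀ x → (x + 1ℤ) - x ≡ 1ℤ
  succ-diff = solve-∀
  pred-diff : ∀ x → (x - 1ℤ) - x ≡ -1ℤ
  pred-diff = solve-∀
  succ²-diff : ∀ x → ((x + 1ℤ) + 1ℤ) - x ≡ + 2
  succ²-diff = solve-∀
  pred²-diff : ∀ x → ((x - 1ℤ) - 1ℤ) - x ≡ -[1+ 1 ]
  pred²-diff = solve-∀

succ≢ : ∀ x → x + 1ℤ ≢ x
succ≢ x = ≢-by-difference 1ℤ (succ-diff x) λ ()
pred≢ : ∀ x → x - 1ℤ ≢ x
pred≢ x = ≢-by-difference -1ℤ (pred-diff x) λ ()
succ²≢ : ∀ x → (x + 1ℤ) + 1ℤ ≢ x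
succ²≢ x = ≢-by-difference (+ 2) (succ²-diff x) λ ()
pred²≢ : ∀ x → (x - 1ℤ) - 1ℤ ≢ x
pred²≢ x = ≢-by-difference -[1+ 1 ] (pred²-diff x) λ ()

fst≢ : ∀ {a b a' b' : ℤ} → a ≢ a' → (a , b) ≢ (a' , b')
fst≢ a≢a' eq = a≢a' (cong proj₁ eq)

snd≢ : ∀ {a b a' b' : ℤ} → b ≢ b' → (a , b) ≢ (a' , b')
snd≢ b≢b' eq = b≢b' (cong proj₂ eq)

decompose : ∀ i j (w : V) → w ≡ (i + (proj₁ w - i) , j + (proj₂ w - j))
decompose i j (w₁ , w₂) = cong₂ _,_ (add-back i w₁) (add-back j w₂)
  where add-back : ∀ i x → x ≡ i + (x - i)
        add-back = solve-∀

origin-shift : ∀ i j → (i + 0ℤ , j + 0ℤ) ≡ (i , j)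
origin-shift i j = cong₂ _,_ (ℤP.+-identityʳ i) (ℤP.+-identityʳ j)

unit-neg : ∀ {u} → IsUnit u → IsUnit (- u)
unit-neg (inj₁ refl) = inj₂ refl
unit-neg (inj₂ refl) = inj₁ refl

unit-swap : ∀ {x y} → IsUnit (x - y) → IsUnit (y - x)
unit-swap {x} {y} u = subst IsUnit (neg-difference x y) (unit-neg u)
  where neg-difference : ∀ x y → - (x - y) ≡ y - x
        neg-difference = solve-∀

pos-unit : ∀ {e} → IsUnit e → pos e ≡ 1ℤ - pos (- e)
pos-unit (inj₁ refl) = refl
pos-unit (inj₂ refl) = refl

pos-split : ∀ σ → pos σ ≡ σ + pos (- σ)
pos-split (+ zero)  = refl
pos-split (+ suc n) = sym (ℤP.+-identityʳ (+ suc n))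
pos-split -[1+ n ]  = sym (ℤP.+-inverseˡ (+ suc n))

-- The monomials I and J

window : (ℤ → Mono) → ℤ → ℕ → Mono
window g x n = prodFrom (x - + n) (suc (n ℕ.+ n)) g

prodFrom-shift : ∀ x lo n (g : ℤ → Mono) p →
                 prodFrom lo n (λ s → g (x + s)) p ≡ prodFrom (x + lo) n g p
prodFrom-shift x lo zero    g p = refl
prodFrom-shift x lo (suc n) g p = cong (g (x + lo) p +ℤ_) (begin
  prodFrom (lo + 1ℤ) n (λ s → g (x + s)) p ≡⟨ prodFrom-shift x (lo + 1ℤ) n g p ⟩
  prodFrom (x + (lo + 1ℤ)) n g p           ≡⟨ cong (λ t → prodFrom t n g p) (sym (ℤP.+-assoc x lo 1ℤ)) ⟩
  prodFrom ((x + lo) + 1ℤ) n g p           ∎)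
  where open ≡-Reasoning

I-window : ∀ a b n → I a b -[1+ n ] ≈ window (λ t → c t b) a n
I-window a b n = prodFrom-shift a (- + n) (suc (n ℕ.+ n)) (λ t → c t b)

J-window : ∀ a b n → J a b (+ n) ≈ window (c a) b n
J-window a b n = prodFrom-shift b (- + n) (suc (n ℕ.+ n)) (c a)

module _ (g : ℤ → Mono) (p : V) where

  private
    peel₂ : ∀ lo m {lo'} → lo + + 2 ≡ lo' →
            prodFrom lo (2 ℕ.+ m) g p ≡ g lo p + (g (lo + 1ℤ) p + prodFrom lo' m g p)
    peel₂ lo m refl = cong (λ t → g lo p + (g (lo + 1ℤ) p + prodFrom t m g p)) (ℤP.+-assoc lo 1ℤ 1ℤ)

    outer-start : ∀ x n → (x - (1ℤ + (1ℤ + n))) + + 2 ≡ (x + 1ℤ) - (1ℤ + n)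
    outer-start = solve-∀

    inner-start : ∀ x n → (x - 1ℤ) - (1ℤ + n) ≡ x - (1ℤ + (1ℤ + n))
    inner-start = solve-∀

    inner-rest : ∀ x n → (x - (1ℤ + (1ℤ + n))) + + 2 ≡ x - n
    inner-rest = solve-∀

    regroup : ∀ (a b u v : ℤ) → (a + (b + u)) + v ≡ (a + (b + v)) + u
    regroup = solve-∀

    outer : ∀ x n → window g x (2 ℕ.+ n) p
                  ≡ g (x - + suc (suc n)) p + (g ((x - + suc (suc n)) + 1ℤ) p + window g (x + 1ℤ) (suc n) p)
    outer x n = trans (cong (λ m → prodFrom (x - + suc (suc n)) (3 ℕ.+ m) g p) (ℕP.+-suc n (suc n)))
                      (peel₂ (x - + suc (suc n)) (suc (suc (n ℕ.+ suc n))) (outer-start x (+ n)))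

    inner : ∀ x n → window g (x - 1ℤ) (suc n) p
                  ≡ g (x - + suc (suc n)) p + (g ((x - + suc (suc n)) + 1ℤ) p + window g x n p)
    inner x n = trans (cong₂ (λ lo m → prodFrom lo (2 ℕ.+ m) g p) (inner-start x (+ n)) (ℕP.+-suc n n))
                      (peel₂ (x - + suc (suc n)) (suc (n ℕ.+ n)) (inner-rest x (+ n)))

  -- Dropping the two lowest factors turns window x (n + 2) into window (x + 1) (n + 1),
  -- and window (x - 1) (n + 1) into window x n.
  window-balance : ∀ x n →
    window g x (2 ℕ.+ n) p + window g x n p ≡ window g (x - 1ℤ) (suc n) p + window g (x + 1ℤ) (suc n) p
  window-balance x n = begin
    window g x (2 ℕ.+ n) p + window g x n p
      ≡⟨ cong (_+ℤ window g x n p) (outer x n) ⟩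
    (g L p + (g (L + 1ℤ) p + window g (x + 1ℤ) (suc n) p)) + window g x n p
      ≡⟨ regroup (g L p) (g (L + 1ℤ) p) _ _ ⟩
    (g L p + (g (L + 1ℤ) p + window g x n p)) + window g (x + 1ℤ) (suc n) p
      ≡⟨ cong (_+ℤ window g (x + 1ℤ) (suc n) p) (sym (inner x n)) ⟩
    window g (x - 1ℤ) (suc n) p + window g (x + 1ℤ) (suc n) p ∎
    where
    open ≡-Reasoning
    L = x - + suc (suc n)

private
  centre-zero : ∀ (x y z : ℤ) →
    (((x + 0ℤ) + 0ℤ) + (y + 0ℤ)) + (z + 0ℤ) ≡ ((0ℤ + (y + (x + (z + 0ℤ)))) + 0ℤ) + 0ℤ
  centre-zero = solve-∀

  centre-minus-one : ∀ (x y z : ℤ) →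
    (((y + (x + (z + 0ℤ))) + 0ℤ) + 0ℤ) + 0ℤ ≡ ((0ℤ + (x + 0ℤ)) + (y + 0ℤ)) + (z + 0ℤ)
  centre-minus-one = solve-∀

  pad-left : ∀ (x y : ℤ) → ((0ℤ + 0ℤ) + x) + y ≡ x + y
  pad-left = solve-∀

  pad-right : ∀ (x y : ℤ) → ((x + y) + 0ℤ) + 0ℤ ≡ x + y
  pad-right = solve-∀

IJ-balance : ∀ a b m p →
  ((I a b (m - 1ℤ) p + I a b (m + 1ℤ) p) + J a (b - 1ℤ) m p) + J a (b + 1ℤ) m p
  ≡ ((J a b (m - 1ℤ) p + J a b (m + 1ℤ) p) + I (a - 1ℤ) b m p) + I (a + 1ℤ) b m p
IJ-balance a b (+ zero) p
  rewrite ℤP.+-identityʳ a | ℤP.+-identityʳ b | ℤP.+-identityʳ (b - 1ℤ) | ℤP.+-identityʳ (b + 1ℤ)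
  = centre-zero (c a b p) (c a (b - 1ℤ) p) (c a (b + 1ℤ) p)
IJ-balance a b -[1+ zero ] p
  rewrite ℤP.+-identityʳ a | ℤP.+-identityʳ b | ℤP.+-identityʳ (a - 1ℤ) | ℤP.+-identityʳ (a + 1ℤ)
  = centre-minus-one (c a b p) (c (a - 1ℤ) b p) (c (a + 1ℤ) b p)
IJ-balance a b (+ suc n) p = begin
  ((0ℤ + 0ℤ) + J a (b - 1ℤ) (+ suc n) p) + J a (b + 1ℤ) (+ suc n) p
    ≡⟨ pad-left (J a (b - 1ℤ) (+ suc n) p) (J a (b + 1ℤ) (+ suc n) p) ⟩
  J a (b - 1ℤ) (+ suc n) p + J a (b + 1ℤ) (+ suc n) p
    ≡⟨ cong₂ _+ℤ_ (J-window a (b - 1ℤ) (suc n) p) (J-window a (b + 1ℤ) (suc n) p) ⟩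
  window (c a) (b - 1ℤ) (suc n) p + window (c a) (b + 1ℤ) (suc n) p
    ≡⟨ sym (window-balance (c a) p b n) ⟩
  window (c a) b (2 ℕ.+ n) p + window (c a) b n p
    ≡⟨ sym (cong₂ _+ℤ_ (J-window a b (2 ℕ.+ n) p) (J-window a b n p)) ⟩
  J a b (+ suc (suc n)) p + J a b (+ n) p
    ≡⟨ ℤP.+-comm (J a b (+ suc (suc n)) p) (J a b (+ n) p) ⟩
  J a b (+ n) p + J a b (+ suc (suc n)) p
    ≡⟨ cong (λ m → J a b (+ n) p + J a b (+ m) p) (ℕP.+-comm 1 (suc n)) ⟩
  J a b (+ n) p + J a b (+ suc n + 1ℤ) p
    ≡⟨ sym (pad-right (J a b (+ n) p) (J a b (+ suc n + 1ℤ) p)) ⟩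
  ((J a b (+ n) p + J a b (+ suc n + 1ℤ) p) + 0ℤ) + 0ℤ ∎
  where open ≡-Reasoning
IJ-balance a b -[1+ suc n ] p = begin
  ((I a b (-[1+ suc n ] - 1ℤ) p + I a b -[1+ n ] p) + 0ℤ) + 0ℤ
    ≡⟨ pad-right (I a b (-[1+ suc n ] - 1ℤ) p) (I a b -[1+ n ] p) ⟩
  I a b (-[1+ suc n ] - 1ℤ) p + I a b -[1+ n ] p
    ≡⟨ cong (λ m → I a b -[1+ suc (suc m) ] p + I a b -[1+ n ] p) (ℕP.+-identityʳ n) ⟩
  I a b -[1+ suc (suc n) ] p + I a b -[1+ n ] p
    ≡⟨ cong₂ _+ℤ_ (I-window a b (2 ℕ.+ n) p) (I-window a b n p) ⟩
  window g a (2 ℕ.+ n) p + window g a n p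
    ≡⟨ window-balance g p a n ⟩
  window g (a - 1ℤ) (suc n) p + window g (a + 1ℤ) (suc n) p
    ≡⟨ sym (cong₂ _+ℤ_ (I-window (a - 1ℤ) b (suc n) p) (I-window (a + 1ℤ) b (suc n) p)) ⟩
  I (a - 1ℤ) b -[1+ suc n ] p + I (a + 1ℤ) b -[1+ suc n ] p
    ≡⟨ sym (pad-left (I (a - 1ℤ) b -[1+ suc n ] p) (I (a + 1ℤ) b -[1+ suc n ] p)) ⟩
  ((0ℤ + 0ℤ) + I (a - 1ℤ) b -[1+ suc n ] p) + I (a + 1ℤ) b -[1+ suc n ] p ∎
  where
  open ≡-Reasoning
  g = λ t → c t b

yBelow : (i j k ε₁ ε₂ ε₃ ε₄ : ℤ) → Mono
yBelow i j k ε₁ ε₂ ε₃ ε₄ =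
  (I i j (k - 1ℤ) · (J i (j - 1ℤ) k ^ pos ε₁) · (J i (j + 1ℤ) k ^ pos ε₂))
  ÷ (J i j (k - 1ℤ) · (I (i - 1ℤ) j k ^ pos ε₃) · (I (i + 1ℤ) j k ^ pos ε₄))

yAbove : (i j k ε₁ ε₂ ε₃ ε₄ : ℤ) → Mono
yAbove i j k ε₁ ε₂ ε₃ ε₄ =
  (J i j (k + 1ℤ) · (I (i - 1ℤ) j k ^ pos (- ε₃)) · (I (i + 1ℤ) j k ^ pos (- ε₄)))
  ÷ (I i j (k + 1ℤ) · (J i (j - 1ℤ) k ^ pos (- ε₁)) · (J i (j + 1ℤ) k ^ pos (- ε₂)))

coefficient : (V → ℤ) → V → Mono
coefficient h (i , j) =
  yBelow i j (h (i , j)) (h (i , j - 1ℤ) - h (i , j)) (h (i , j + 1ℤ) - h (i , j))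
         (h (i - 1ℤ , j) - h (i , j)) (h (i + 1ℤ , j) - h (i , j))

yBelow-cong : ∀ i j {k k' e₁ e₁' e₂ e₂' e₃ e₃' e₄ e₄'} →
  k ≡ k' → e₁ ≡ e₁' → e₂ ≡ e₂' → e₃ ≡ e₃' → e₄ ≡ e₄' →
  yBelow i j k e₁ e₂ e₃ e₄ ≈ yBelow i j k' e₁' e₂' e₃' e₄'
yBelow-cong i j refl refl refl refl refl p = refl

yBelow≈yAbove : ∀ i j k {ε₁ ε₂ ε₃ ε₄} → IsUnit ε₁ → IsUnit ε₂ → IsUnit ε₃ → IsUnit ε₄ →
  yBelow i j k ε₁ ε₂ ε₃ ε₄ ≈ yAbove i j k ε₁ ε₂ ε₃ ε₄
yBelow≈yAbove i j k {ε₁} {ε₂} {ε₃} {ε₄} u₁ u₂ u₃ u₄ p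
  rewrite pos-unit u₁ | pos-unit u₂ | pos-unit u₃ | pos-unit u₄ = begin
    _ ≡⟨ rearrange I₋ I₊ J₁ J₂ J₋ J₊ I₃ I₄ (pos (- ε₁)) (pos (- ε₂)) (pos (- ε₃)) (pos (- ε₄)) ⟩
    (((I₋ + I₊) + J₁) + J₂) - (((J₋ + J₊) + I₃) + I₄) + yAbove i j k ε₁ ε₂ ε₃ ε₄ p
      ≡⟨ cong (_+ℤ yAbove i j k ε₁ ε₂ ε₃ ε₄ p) (difference-zero (IJ-balance i j k p)) ⟩
    0ℤ + yAbove i j k ε₁ ε₂ ε₃ ε₄ p
      ≡⟨ ℤP.+-identityˡ _ ⟩
    yAbove i j k ε₁ ε₂ ε₃ ε₄ p ∎
  where
  open ≡-Reasoning
  I₋ = I i j (k - 1ℤ) p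
  I₊ = I i j (k + 1ℤ) p
  J₋ = J i j (k - 1ℤ) p
  J₊ = J i j (k + 1ℤ) p
  J₁ = J i (j - 1ℤ) k p
  J₂ = J i (j + 1ℤ) k p
  I₃ = I (i - 1ℤ) j k p
  I₄ = I (i + 1ℤ) j k p

  difference-zero : ∀ {x y} → x ≡ y → x - y ≡ 0ℤ
  difference-zero {x} refl = ℤP.+-inverseʳ x

  rearrange : ∀ (I₋ I₊ J₁ J₂ J₋ J₊ I₃ I₄ q₁ q₂ q₃ q₄ : ℤ) →
    ((I₋ + (1ℤ - q₁) * J₁) + (1ℤ - q₂) * J₂) + - ((J₋ + (1ℤ - q₃) * I₃) + (1ℤ - q₄) * I₄)
    ≡ (((I₋ + I₊) + J₁) + J₂) - (((J₋ + J₊) + I₃) + I₄)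
      + (((J₊ + q₃ * I₃) + q₄ * I₄) + - ((I₊ + q₁ * J₁) + q₂ * J₂))
  rearrange = solve-∀

module _ (i j k : ℤ) (p : V) where
  private
    move₁ : ∀ (A B D X σ q : ℤ) → ((A + (σ + q) * X) + B) + - D ≡ (((A + q * X) + B) + - D) + σ * X
    move₁ = solve-∀
    move₂ : ∀ (A B D X σ q : ℤ) → ((A + B) + (σ + q) * X) + - D ≡ (((A + B) + q * X) + - D) + σ * X
    move₂ = solve-∀
    move₃ : ∀ (N D E X σ q : ℤ) → N + - ((D + (σ + q) * X) + E) ≡ (N + - ((D + q * X) + E)) + - σ * X
    move₃ = solve-∀
    move₄ : ∀ (N D E X σ q : ℤ) → N + - ((D + E) + (σ + q) * X) ≡ (N + - ((D + E) + q * X)) + - σ * X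
    move₄ = solve-∀

  yBelow-flip₁ : ∀ σ e₂ e₃ e₄ →
    yBelow i j k σ e₂ e₃ e₄ p ≡ yBelow i j k (- σ) e₂ e₃ e₄ p + σ * J i (j - 1ℤ) k p
  yBelow-flip₁ σ e₂ e₃ e₄ rewrite pos-split σ =
    move₁ (I i j (k - 1ℤ) p) ((J i (j + 1ℤ) k ^ pos e₂) p)
          ((J i j (k - 1ℤ) · (I (i - 1ℤ) j k ^ pos e₃) · (I (i + 1ℤ) j k ^ pos e₄)) p)
          (J i (j - 1ℤ) k p) σ (pos (- σ))

  yBelow-flip₂ : ∀ e₁ σ e₃ e₄ →
    yBelow i j k e₁ σ e₃ e₄ p ≡ yBelow i j k e₁ (- σ) e₃ e₄ p + σ * J i (j + 1ℤ) k p
  yBelow-flip₂ e₁ σ e₃ e₄ rewrite pos-split σ =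
    move₂ (I i j (k - 1ℤ) p) ((J i (j - 1ℤ) k ^ pos e₁) p)
          ((J i j (k - 1ℤ) · (I (i - 1ℤ) j k ^ pos e₃) · (I (i + 1ℤ) j k ^ pos e₄)) p)
          (J i (j + 1ℤ) k p) σ (pos (- σ))

  yBelow-flip₃ : ∀ e₁ e₂ σ e₄ →
    yBelow i j k e₁ e₂ σ e₄ p ≡ yBelow i j k e₁ e₂ (- σ) e₄ p + - σ * I (i - 1ℤ) j k p
  yBelow-flip₃ e₁ e₂ σ e₄ rewrite pos-split σ =
    move₃ ((I i j (k - 1ℤ) · (J i (j - 1ℤ) k ^ pos e₁) · (J i (j + 1ℤ) k ^ pos e₂)) p)
          (J i j (k - 1ℤ) p) ((I (i + 1ℤ) j k ^ pos e₄) p) (I (i - 1ℤ) j k p) σ (pos (- σ))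

  yBelow-flip₄ : ∀ e₁ e₂ e₃ σ →
    yBelow i j k e₁ e₂ e₃ σ p ≡ yBelow i j k e₁ e₂ e₃ (- σ) p + - σ * I (i + 1ℤ) j k p
  yBelow-flip₄ e₁ e₂ e₃ σ rewrite pos-split σ =
    move₄ ((I i j (k - 1ℤ) · (J i (j - 1ℤ) k ^ pos e₁) · (J i (j + 1ℤ) k ^ pos e₂)) p)
          (J i j (k - 1ℤ) p) ((I (i - 1ℤ) j k ^ pos e₃) p) (I (i + 1ℤ) j k p) σ (pos (- σ))

yBelow-uniform : ∀ i j k {σ} → IsUnit σ →
  yBelow i j k σ σ σ σ ≈ (J i j (k + σ) ÷ I i j (k + σ)) ^ σ
yBelow-uniform i j k (inj₁ refl) p =
  trans (yBelow≈yAbove i j k (inj₁ refl) (inj₁ refl) (inj₁ refl) (inj₁ refl) p)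
        (simplify (J i j (k + 1ℤ) p) (I i j (k + 1ℤ) p) (I (i - 1ℤ) j k p) (I (i + 1ℤ) j k p)
                  (J i (j - 1ℤ) k p) (J i (j + 1ℤ) k p))
  where
  simplify : ∀ (J₊ I₊ I₃ I₄ J₁ J₂ : ℤ) →
    ((J₊ + 0ℤ * I₃) + 0ℤ * I₄) + - ((I₊ + 0ℤ * J₁) + 0ℤ * J₂) ≡ 1ℤ * (J₊ + - I₊)
  simplify = solve-∀
yBelow-uniform i j k (inj₂ refl) p =
  simplify (I i j (k - 1ℤ) p) (J i j (k - 1ℤ) p) (I (i - 1ℤ) j k p) (I (i + 1ℤ) j k p)
           (J i (j - 1ℤ) k p) (J i (j + 1ℤ) k p)
  where
  simplify : ∀ (I₋ J₋ I₃ I₄ J₁ J₂ : ℤ) →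
    ((I₋ + 0ℤ * J₁) + 0ℤ * J₂) + - ((J₋ + 0ℤ * I₃) + 0ℤ * I₄) ≡ -1ℤ * (J₋ + - I₋)
  simplify = solve-∀

-- Tropical arithmetic

Nonnegative : Mono → Set
Nonnegative f = ∀ p → 0ℤ ≤ f p

c-nonnegative : ∀ a b → Nonnegative (c a b)
c-nonnegative a b (x , y) with x ==ℤ a | y ==ℤ b
... | true  | true  = +≤+ z≤n
... | true  | false = +≤+ z≤n
... | false | true  = +≤+ z≤n
... | false | false = +≤+ z≤n

prodFrom-nonnegative : ∀ lo n (f : ℤ → Mono) → (∀ s → Nonnegative (f s)) → Nonnegative (prodFrom lo n f)
prodFrom-nonnegative lo zero    f f≥0 p = +≤+ z≤n
prodFrom-nonnegative lo (suc n) f f≥0 p = ℤP.+-mono-≤ (f≥0 lo p) (prodFrom-nonnegative (lo + 1ℤ) n f f≥0 p)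

I-nonnegative : ∀ a b m → Nonnegative (I a b m)
I-nonnegative a b (+ _)    p = +≤+ z≤n
I-nonnegative a b -[1+ n ] = prodFrom-nonnegative (- + n) (suc (n ℕ.+ n)) _ (λ s → c-nonnegative (a + s) b)

J-nonnegative : ∀ a b m → Nonnegative (J a b m)
J-nonnegative a b -[1+ _ ] p = +≤+ z≤n
J-nonnegative a b (+ n)    = prodFrom-nonnegative (- + n) (suc (n ℕ.+ n)) _ (λ s → c-nonnegative a (b + s))

I-or-J-trivial : ∀ a b m → I a b m ≈ one ⊎ J a b m ≈ one
I-or-J-trivial a b (+ _)    = inj₁ λ _ → refl
I-or-J-trivial a b -[1+ _ ] = inj₂ λ _ → refl

yplus-yminus-ratio : ∀ {f P Q} → Nonnegative P → Nonnegative Q → P ≈ one ⊎ Q ≈ one →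
                     f ≈ P ÷ Q → yplus f ≈ P × yminus f ≈ Q
yplus-yminus-ratio {f} {P} {Q} P≥0 Q≥0 trivial f≈P/Q =
  (λ p → trans (cong (λ t → t + - (t ⊓ 0ℤ)) (f≈P/Q p))
               (trans (cong (λ t → (P p - Q p) + - t) (min-zero p)) (cancel (P p) (Q p)))) ,
  (λ p → trans (cong (λ t → 0ℤ + - (t ⊓ 0ℤ)) (f≈P/Q p))
               (trans (cong (λ t → 0ℤ + - t) (min-zero p)) (double-neg (Q p))))
  where
  cancel : ∀ (x y : ℤ) → (x - y) + - - y ≡ x
  cancel = solve-∀
  double-neg : ∀ (y : ℤ) → 0ℤ + - - y ≡ y
  double-neg = solve-∀

  min-zero′ : P ≈ one ⊎ Q ≈ one → ∀ p → (P p - Q p) ⊓ 0ℤ ≡ - Q p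
  min-zero′ (inj₁ P≈1) p rewrite P≈1 p | ℤP.+-identityˡ (- Q p) = ℤP.i≤j⇒i⊓j≡i (ℤP.neg-mono-≤ (Q≥0 p))
  min-zero′ (inj₂ Q≈1) p rewrite Q≈1 p | ℤP.+-identityʳ (P p) = ℤP.i≥j⇒i⊓j≡j (P≥0 p)

  min-zero : ∀ p → (P p - Q p) ⊓ 0ℤ ≡ - Q p
  min-zero = min-zero′ trivial

increment : ℤ → Mono → Mono
increment b f = (yplus f ^ pos b) · (yminus f ^ (- pos (- b)))

mutY-elsewhere : ∀ b yy v w → w ≢ v → mutY b yy v w ≈ yy w · increment (b v w) (yy v)
mutY-elsewhere b yy v w w≢v p rewrite ==V-false w≢v = ℤP.+-assoc (yy w p) _ _

mutY-here : ∀ b yy v → mutY b yy v v ≈ inv (yy v)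
mutY-here b yy v p rewrite ==V-true {v} refl = refl

private
  keep-first : ∀ (x y : ℤ) → 1ℤ * x + 0ℤ * y ≡ 1ℤ * x
  keep-first = solve-∀
  keep-second : ∀ (x y : ℤ) → 0ℤ * x + -1ℤ * y ≡ -1ℤ * y
  keep-second = solve-∀

increment-ratio-power : ∀ {σ f P Q} → IsUnit σ → Nonnegative P → Nonnegative Q → P ≈ one ⊎ Q ≈ one →
  f ≈ (P ÷ Q) ^ σ → increment σ f ≈ P ^ σ × increment (- σ) f ≈ Q ^ (- σ)
increment-ratio-power {f = f} {P} {Q} (inj₁ refl) P≥0 Q≥0 trivial f≈ =
  (λ p → trans (cong₂ (λ a b → 1ℤ * a + 0ℤ * b) (y⁺ p) (y⁻ p)) (keep-first (P p) (Q p))) ,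
  (λ p → trans (cong₂ (λ a b → 0ℤ * a + -1ℤ * b) (y⁺ p) (y⁻ p)) (keep-second (P p) (Q p)))
  where
  f≈P/Q : f ≈ P ÷ Q
  f≈P/Q p = trans (f≈ p) (ℤP.*-identityˡ _)
  y⁺ = proj₁ (yplus-yminus-ratio P≥0 Q≥0 trivial f≈P/Q)
  y⁻ = proj₂ (yplus-yminus-ratio P≥0 Q≥0 trivial f≈P/Q)

increment-ratio-power {f = f} {P} {Q} (inj₂ refl) P≥0 Q≥0 trivial f≈ =
  (λ p → trans (cong₂ (λ a b → 0ℤ * a + -1ℤ * b) (y⁺ p) (y⁻ p)) (keep-second (Q p) (P p))) ,
  (λ p → trans (cong₂ (λ a b → 1ℤ * a + 0ℤ * b) (y⁺ p) (y⁻ p)) (keep-first (Q p) (P p)))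
  where
  invert : ∀ (x y : ℤ) → -1ℤ * (x + - y) ≡ y + - x
  invert = solve-∀
  f≈Q/P : f ≈ Q ÷ P
  f≈Q/P p = trans (f≈ p) (invert (P p) (Q p))
  y⁺ = proj₁ (yplus-yminus-ratio Q≥0 P≥0 (swap trivial) f≈Q/P)
  y⁻ = proj₂ (yplus-yminus-ratio Q≥0 P≥0 (swap trivial) f≈Q/P)

-- The exchange matrix of a stepped surface

data Displacement : Set where
  back stay forward distant : Displacement

displacement : ℤ → Displacement
displacement (+ 0)           = stay
displacement (+ 1)           = forward
displacement (+ suc (suc _)) = distant
displacement -[1+ 0 ]        = back
displacement -[1+ suc _ ]    = distant

data Position : Set where
  same east west north south northEast northWest southEast southWest apart : Position

positionOf : Displacement → Displacement → Position
positionOf distant _       = apart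
positionOf _       distant = apart
positionOf stay    stay    = same
positionOf forward stay    = east
positionOf back    stay    = west
positionOf stay    forward = north
positionOf stay    back    = south
positionOf forward forward = northEast
positionOf back    forward = northWest
positionOf forward back    = southEast
positionOf back    back    = southWest

position : ℤ → ℤ → Position
position dx dy = positionOf (displacement dx) (displacement dy)

axisWeight : Position → ℤ → ℤ → ℤ
axisWeight east  hu hw = hu - hw
axisWeight west  hu hw = hu - hw
axisWeight north hu hw = hw - hu
axisWeight south hu hw = hw - hu
axisWeight _     _  _  = 0ℤ

diagonal : Position → ℤ
diagonal northEast = 1ℤ
diagonal northWest = 1ℤ
diagonal southEast = 1ℤ
diagonal southWest = 1ℤ
diagonal _         = 0ℤ

-- b_{uw} for u = (a , b), w = (a' , b') when the heights are r: horizontal arrows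
-- point from higher to lower vertices, vertical ones from lower to higher, and
-- diagonal neighbours are joined according to the two other corners of their square.
exchangeOn : (ℤ → ℤ → ℤ) → ℤ → ℤ → ℤ → ℤ → ℤ
exchangeOn r a b a' b' =
  axisWeight (position (a' - a) (b' - b)) (r a b) (r a' b')
  + diagonal (position (a' - a) (b' - b)) * sgn (r a' b - r a b')

exchange : (V → ℤ) → V → V → ℤ
exchange h (u₁ , u₂) (w₁ , w₂) = exchangeOn (curry h) u₁ u₂ w₁ w₂

around : (V → ℤ) → V → ℤ → ℤ → ℤ
around h (i , j) x y = h (i + x , j + y)

mutateAtOrigin : (ℤ → ℤ → ℤ → ℤ → ℤ) → ℤ → ℤ → ℤ → ℤ → ℤ
mutateAtOrigin bl a b a' b' =
  if isOrigin a b ∨ isOrigin a' b' then - bl a b a' b'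
  else bl a b a' b' + sgn (bl a b 0ℤ 0ℤ) * pos (bl a b 0ℤ 0ℤ * bl 0ℤ 0ℤ a' b')

private
  difference-shift : ∀ i a a' → (i + a') - (i + a) ≡ a' - a
  difference-shift = solve-∀

exchange-around : ∀ h i j a b a' b' →
  exchange h (i + a , j + b) (i + a' , j + b') ≡ exchangeOn (around h (i , j)) a b a' b'
exchange-around h i j a b a' b' rewrite difference-shift i a a' | difference-shift j b b' = refl

==V-shift : ∀ i j a b → ((i + a , j + b) ==V (i , j)) ≡ isOrigin a b
==V-shift i j a b with (a , b) ≟V (0ℤ , 0ℤ)
... | yes refl = trans (==V-true (cong₂ _,_ (ℤP.+-identityʳ i) (ℤP.+-identityʳ j)))
                       (sym (==V-true {0ℤ , 0ℤ} refl))
... | no ab≢0 = trans (==V-false shifted≢) (sym (==V-false ab≢0))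
  where
  shifted≢ : (i + a , j + b) ≢ (i , j)
  shifted≢ eq = ab≢0 (cong₂ _,_
    (+-cancelˡ i (trans (cong proj₁ eq) (sym (ℤP.+-identityʳ i))))
    (+-cancelˡ j (trans (cong proj₂ eq) (sym (ℤP.+-identityʳ j)))))

exchange-to-centre : ∀ h i j a b →
  exchange h (i + a , j + b) (i , j) ≡ exchangeOn (around h (i , j)) a b 0ℤ 0ℤ
exchange-to-centre h i j a b =
  trans (cong (exchange h (i + a , j + b)) (sym (origin-shift i j))) (exchange-around h i j a b 0ℤ 0ℤ)

exchange-from-centre : ∀ h i j a b →
  exchange h (i , j) (i + a , j + b) ≡ exchangeOn (around h (i , j)) 0ℤ 0ℤ a b
exchange-from-centre h i j a b =
  trans (cong (λ u → exchange h u (i + a , j + b)) (sym (origin-shift i j))) (exchange-around h i j 0ℤ 0ℤ a b)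

mutB-around : ∀ h i j a b a' b' →
  mutB (exchange h) (i , j) (i + a , j + b) (i + a' , j + b')
  ≡ mutateAtOrigin (exchangeOn (around h (i , j))) a b a' b'
mutB-around h i j a b a' b'
  rewrite ==V-shift i j a b | ==V-shift i j a' b' | exchange-around h i j a b a' b'
        | exchange-to-centre h i j a b | exchange-from-centre h i j a' b' = refl

around-mutH : ∀ h i j d x y →
  around (mutH h (i , j) d) (i , j) x y ≡ (if isOrigin x y then h (i , j) + d else around h (i , j) x y)
around-mutH h i j d x y rewrite ==V-shift i j x y = refl

atPosition : (c σ τ₁ τ₂ τ₃ τ₄ : ℤ) → Position → ℤ
atPosition c σ τ₁ τ₂ τ₃ τ₄ same      = c
atPosition c σ τ₁ τ₂ τ₃ τ₄ east      = σ
atPosition c σ τ₁ τ₂ τ₃ τ₄ west      = σ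
atPosition c σ τ₁ τ₂ τ₃ τ₄ north     = σ
atPosition c σ τ₁ τ₂ τ₃ τ₄ south     = σ
atPosition c σ τ₁ τ₂ τ₃ τ₄ northEast = σ + τ₁
atPosition c σ τ₁ τ₂ τ₃ τ₄ northWest = σ + τ₂
atPosition c σ τ₁ τ₂ τ₃ τ₄ southEast = σ + τ₃
atPosition c σ τ₁ τ₂ τ₃ τ₄ southWest = σ + τ₄
atPosition c σ τ₁ τ₂ τ₃ τ₄ apart     = 0ℤ

-- Heights on the 3 × 3 block around a vertex of height c whose four lattice
-- neighbours lie at height σ; the corners differ from the neighbours by τ₁ … τ₄.
blockHeights : (c σ τ₁ τ₂ τ₃ τ₄ : ℤ) → ℤ → ℤ → ℤ
blockHeights c σ τ₁ τ₂ τ₃ τ₄ x y = atPosition c σ τ₁ τ₂ τ₃ τ₄ (position x y)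

offsets : List ℤ
offsets = -1ℤ ∷ 0ℤ ∷ 1ℤ ∷ []

pattern -1∈ = here refl
pattern 0∈ = there (here refl)
pattern 1∈ = there (there (here refl))

units : List ℤ
units = 1ℤ ∷ -1ℤ ∷ []

unit∈units : ∀ {σ} → IsUnit σ → σ ∈ units
unit∈units (inj₁ refl) = here refl
unit∈units (inj₂ refl) = there (here refl)

infixr 5 _⊗_
_⊗_ : ∀ {A B : Set} → List A → List B → List (A × B)
_⊗_ = cartesianProduct

BlockConfiguration : Set
BlockConfiguration = ℤ × ℤ × ℤ × ℤ × ℤ × ℤ × ℤ × ℤ × ℤ

blockConfigurations : List BlockConfiguration
blockConfigurations = units ⊗ units ⊗ units ⊗ units ⊗ units ⊗ offsets ⊗ offsets ⊗ offsets ⊗ offsets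

blockMutationRule : BlockConfiguration → Bool
blockMutationRule (σ , τ₁ , τ₂ , τ₃ , τ₄ , a , b , a' , b') =
  ⌊ mutateAtOrigin (exchangeOn (blockHeights 0ℤ σ τ₁ τ₂ τ₃ τ₄)) a b a' b'
    ℤ.≟ exchangeOn (blockHeights (σ + σ) σ τ₁ τ₂ τ₃ τ₄) a b a' b' ⌋

-- Checked by evaluation on all 2592 configurations.
block-mutation : ∀ {σ τ₁ τ₂ τ₃ τ₄ a b a' b'} →
  IsUnit σ → IsUnit τ₁ → IsUnit τ₂ → IsUnit τ₃ → IsUnit τ₄ →
  a ∈ offsets → b ∈ offsets → a' ∈ offsets → b' ∈ offsets →
  mutateAtOrigin (exchangeOn (blockHeights 0ℤ σ τ₁ τ₂ τ₃ τ₄)) a b a' b'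
  ≡ exchangeOn (blockHeights (σ + σ) σ τ₁ τ₂ τ₃ τ₄) a b a' b'
block-mutation uσ u₁ u₂ u₃ u₄ a∈ b∈ a'∈ b'∈ =
  toWitness (lookup (all⁺ blockMutationRule blockConfigurations _)
    (∈-cartesianProduct⁺ (unit∈units uσ) (∈-cartesianProduct⁺ (unit∈units u₁)
    (∈-cartesianProduct⁺ (unit∈units u₂) (∈-cartesianProduct⁺ (unit∈units u₃)
    (∈-cartesianProduct⁺ (unit∈units u₄) (∈-cartesianProduct⁺ a∈
    (∈-cartesianProduct⁺ b∈ (∈-cartesianProduct⁺ a'∈ b'∈)))))))))

private
  difference-offset : ∀ k x y → (k + x) - (k + y) ≡ x - y
  difference-offset = solve-∀

weights-offset : ∀ o k x y {s s'} → (diagonal o ≡ 1ℤ → s ≡ s') →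
  axisWeight o (k + x) (k + y) + diagonal o * sgn s ≡ axisWeight o x y + diagonal o * sgn s'
weights-offset same      k x y s≡s' = refl
weights-offset east      k x y s≡s' = cong (_+ℤ 0ℤ) (difference-offset k x y)
weights-offset west      k x y s≡s' = cong (_+ℤ 0ℤ) (difference-offset k x y)
weights-offset north     k x y s≡s' = cong (_+ℤ 0ℤ) (difference-offset k y x)
weights-offset south     k x y s≡s' = cong (_+ℤ 0ℤ) (difference-offset k y x)
weights-offset northEast k x y s≡s' = cong (λ s → 0ℤ + 1ℤ * sgn s) (s≡s' refl)
weights-offset northWest k x y s≡s' = cong (λ s → 0ℤ + 1ℤ * sgn s) (s≡s' refl)
weights-offset southEast k x y s≡s' = cong (λ s → 0ℤ + 1ℤ * sgn s) (s≡s' refl)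
weights-offset southWest k x y s≡s' = cong (λ s → 0ℤ + 1ℤ * sgn s) (s≡s' refl)
weights-offset apart     k x y s≡s' = refl

exchangeOn-cong : ∀ {r r'} → (∀ x y → r x y ≡ r' x y) →
                  ∀ a b a' b' → exchangeOn r a b a' b' ≡ exchangeOn r' a b a' b'
exchangeOn-cong r≗r' a b a' b' =
  cong₂ _+ℤ_ (cong₂ (axisWeight (position (a' - a) (b' - b))) (r≗r' a b) (r≗r' a' b'))
             (cong (λ t → diagonal (position (a' - a) (b' - b)) * sgn t) (cong₂ _-_ (r≗r' a' b) (r≗r' a b')))

exchangeOn-offset : ∀ r r' k a b a' b' → r a b ≡ k + r' a b → r a' b' ≡ k + r' a' b' →
  (diagonal (position (a' - a) (b' - b)) ≡ 1ℤ → r a' b ≡ k + r' a' b × r a b' ≡ k + r' a b') →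
  exchangeOn r a b a' b' ≡ exchangeOn r' a b a' b'
exchangeOn-offset r r' k a b a' b' e e' corners rewrite e | e' =
  weights-offset (position (a' - a) (b' - b)) k (r' a b) (r' a' b') corner-difference
  where
  corner-difference : diagonal (position (a' - a) (b' - b)) ≡ 1ℤ → r a' b - r a b' ≡ r' a' b - r' a b'
  corner-difference d with corners d
  ... | c₁ , c₂ rewrite c₁ | c₂ = difference-offset k (r' a' b) (r' a b')

OnBlock : (ℤ → ℤ → ℤ) → ℤ → (ℤ → ℤ → ℤ) → Set
OnBlock r k r' = ∀ {x y} → x ∈ offsets → y ∈ offsets → r x y ≡ k + r' x y


module _ {r r' k} (on : OnBlock r k r') where

  exchangeOn-block : ∀ {a b a' b'} → a ∈ offsets → b ∈ offsets → a' ∈ offsets → b' ∈ offsets →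
                     exchangeOn r a b a' b' ≡ exchangeOn r' a b a' b'
  exchangeOn-block {a} {b} {a'} {b'} a∈ b∈ a'∈ b'∈ =
    exchangeOn-offset r r' k a b a' b' (on a∈ b∈) (on a'∈ b'∈) (λ _ → on a'∈ b∈ , on a∈ b'∈)

  mutateAtOrigin-block : ∀ {a b a' b'} → a ∈ offsets → b ∈ offsets → a' ∈ offsets → b' ∈ offsets →
    mutateAtOrigin (exchangeOn r) a b a' b' ≡ mutateAtOrigin (exchangeOn r') a b a' b'
  mutateAtOrigin-block a∈ b∈ a'∈ b'∈
    rewrite exchangeOn-block a∈ b∈ a'∈ b'∈
          | exchangeOn-block a∈ b∈ 0∈ 0∈
          | exchangeOn-block 0∈ 0∈ a'∈ b'∈
    = refl

Distant : ℤ → Set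
Distant a = displacement a ≡ distant

near-or-distant : ∀ a → a ∈ offsets ⊎ Distant a
near-or-distant (+ 0)           = inj₁ 0∈
near-or-distant (+ 1)           = inj₁ 1∈
near-or-distant (+ suc (suc _)) = inj₂ refl
near-or-distant -[1+ 0 ]        = inj₁ -1∈
near-or-distant -[1+ suc _ ]    = inj₂ refl

near-not-distant : ∀ {a} → a ∈ offsets → ¬ Distant a
near-not-distant -1∈ ()
near-not-distant 0∈ ()
near-not-distant 1∈ ()

distant-neg : ∀ {a} → Distant a → Distant (- a)
distant-neg {+ suc (suc _)} _ = refl
distant-neg { -[1+ suc _ ]} _ = refl

distant-to-origin : ∀ {a} → Distant a → Distant (0ℤ - a)
distant-to-origin {a} d = subst Distant (sym (ℤP.+-identityˡ (- a))) (distant-neg d)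

distant-from-origin : ∀ {a} → Distant a → Distant (a - 0ℤ)
distant-from-origin {a} = subst Distant (sym (ℤP.+-identityʳ a))

positionOf-distantʳ : ∀ d → positionOf d distant ≡ apart
positionOf-distantʳ back    = refl
positionOf-distantʳ stay    = refl
positionOf-distantʳ forward = refl
positionOf-distantʳ distant = refl

position-distant : ∀ {x y} → Distant x ⊎ Distant y → position x y ≡ apart
position-distant         (inj₁ d) rewrite d = refl
position-distant {x} {y} (inj₂ d) rewrite d = positionOf-distantʳ (displacement x)

diagonal-near : ∀ x y → diagonal (position x y) ≡ 1ℤ → ¬ Distant x × ¬ Distant y
diagonal-near x y d = (λ dx → 0≢1 (trans (cong diagonal (sym (position-distant (inj₁ dx)))) d))
                    , (λ dy → 0≢1 (trans (cong diagonal (sym (position-distant (inj₂ dy)))) d))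
  where
  0≢1 : 0ℤ ≢ 1ℤ
  0≢1 ()

exchangeOn-distant : ∀ r a b a' b' → Distant (a' - a) ⊎ Distant (b' - b) → exchangeOn r a b a' b' ≡ 0ℤ
exchangeOn-distant r a b a' b' far rewrite position-distant far = refl

Far : ℤ → ℤ → ℤ → ℤ → Set
Far a b a' b' = (Distant a ⊎ Distant b) ⊎ (Distant a' ⊎ Distant b')

exchangeOn-to-origin : ∀ r a b → Distant a ⊎ Distant b → exchangeOn r a b 0ℤ 0ℤ ≡ 0ℤ
exchangeOn-to-origin r a b (inj₁ d) = exchangeOn-distant r a b 0ℤ 0ℤ (inj₁ (distant-to-origin d))
exchangeOn-to-origin r a b (inj₂ d) = exchangeOn-distant r a b 0ℤ 0ℤ (inj₂ (distant-to-origin d))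

exchangeOn-from-origin : ∀ r a' b' → Distant a' ⊎ Distant b' → exchangeOn r 0ℤ 0ℤ a' b' ≡ 0ℤ
exchangeOn-from-origin r a' b' (inj₁ d) = exchangeOn-distant r 0ℤ 0ℤ a' b' (inj₁ (distant-from-origin d))
exchangeOn-from-origin r a' b' (inj₂ d) = exchangeOn-distant r 0ℤ 0ℤ a' b' (inj₂ (distant-from-origin d))

not-far : ∀ {a b a' b'} → Far a b a' b' → ¬ Distant a → ¬ Distant b → ¬ Distant a' → ¬ Distant b' → ⊥
not-far (inj₁ (inj₁ d)) na nb na' nb' = na d
not-far (inj₁ (inj₂ d)) na nb na' nb' = nb d
not-far (inj₂ (inj₁ d)) na nb na' nb' = na' d
not-far (inj₂ (inj₂ d)) na nb na' nb' = nb' d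

corner₁-not-origin : ∀ a b a' b' → Far a b a' b' → diagonal (position (a' - a) (b' - b)) ≡ 1ℤ →
                     ¬ (a' ≡ 0ℤ × b ≡ 0ℤ)
corner₁-not-origin a _ _ b' far d (refl , refl) =
  not-far far (proj₁ near ∘ distant-to-origin) (λ ()) (λ ()) (proj₂ near ∘ distant-from-origin)
  where near = diagonal-near (0ℤ - a) (b' - 0ℤ) d

corner₂-not-origin : ∀ a b a' b' → Far a b a' b' → diagonal (position (a' - a) (b' - b)) ≡ 1ℤ →
                     ¬ (a ≡ 0ℤ × b' ≡ 0ℤ)
corner₂-not-origin _ b a' _ far d (refl , refl) =
  not-far far (λ ()) (proj₂ near ∘ distant-to-origin) (proj₁ near ∘ distant-from-origin) (λ ())
  where near = diagonal-near (a' - 0ℤ) (0ℤ - b) d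

far-from-origin : ∀ {a' b'} → Far 0ℤ 0ℤ a' b' → Distant a' ⊎ Distant b'
far-from-origin (inj₁ (inj₁ ()))
far-from-origin (inj₁ (inj₂ ()))
far-from-origin (inj₂ d) = d

far-to-origin : ∀ {a b} → Far a b 0ℤ 0ℤ → Distant a ⊎ Distant b
far-to-origin (inj₁ d) = d
far-to-origin (inj₂ (inj₁ ()))
far-to-origin (inj₂ (inj₂ ()))

-- Off the block one of b_{u0}, b_{0w} vanishes, and no height entering b_{uw} moves.
mutateAtOrigin-far : ∀ r r' → (∀ {x y} → isOrigin x y ≡ false → r x y ≡ r' x y) →
  ∀ a b a' b' → Far a b a' b' → mutateAtOrigin (exchangeOn r) a b a' b' ≡ exchangeOn r' a b a' b'
mutateAtOrigin-far r r' off-origin a b a' b' far with isOrigin a b in o | isOrigin a' b' in o'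
... | true | _ with refl , refl ← isOrigin-sound {a} {b} o =
  trans (cong -_ (exchangeOn-from-origin r a' b' d)) (sym (exchangeOn-from-origin r' a' b' d))
  where d = far-from-origin far
... | false | true with refl , refl ← isOrigin-sound {a'} {b'} o' =
  trans (cong -_ (exchangeOn-to-origin r a b d)) (sym (exchangeOn-to-origin r' a b d))
  where d = far-to-origin far
... | false | false = begin
  exchangeOn r a b a' b' + sgn X * pos (X * Y) ≡⟨ cong (exchangeOn r a b a' b' +ℤ_) (correction-vanishes far) ⟩
  exchangeOn r a b a' b' + 0ℤ                  ≡⟨ ℤP.+-identityʳ _ ⟩
  exchangeOn r a b a' b'                       ≡⟨ exchangeOn-offset r r' 0ℤ a b a' b' (agree o) (agree o') corners ⟩
  exchangeOn r' a b a' b'                      ∎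
  where
  open ≡-Reasoning
  X = exchangeOn r a b 0ℤ 0ℤ
  Y = exchangeOn r 0ℤ 0ℤ a' b'

  correction-vanishes : Far a b a' b' → sgn X * pos (X * Y) ≡ 0ℤ
  correction-vanishes (inj₁ d) rewrite exchangeOn-to-origin r a b d = refl
  correction-vanishes (inj₂ d) rewrite exchangeOn-from-origin r a' b' d | ℤP.*-zeroʳ X = ℤP.*-zeroʳ (sgn X)

  agree : ∀ {x y} → isOrigin x y ≡ false → r x y ≡ 0ℤ + r' x y
  agree e = trans (off-origin e) (sym (ℤP.+-identityˡ _))

  corners : diagonal (position (a' - a) (b' - b)) ≡ 1ℤ → r a' b ≡ 0ℤ + r' a' b × r a b' ≡ 0ℤ + r' a b'
  corners diag = agree (isOrigin-false (corner₁-not-origin a b a' b' far diag))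
               , agree (isOrigin-false (corner₂-not-origin a b a' b' far diag))

-- Mutation at a vertex whose neighbours share a height

Stepped : (V → ℤ) → Set
Stepped h = ∀ x y → IsUnit (h (x + 1ℤ , y) - h (x , y)) × IsUnit (h (x , y + 1ℤ) - h (x , y))

mutH-at : ∀ h v d → mutH h v d v ≡ h v + d
mutH-at h v d rewrite ==V-true {v} refl = refl

mutH-off : ∀ h v d {w} → w ≢ v → mutH h v d w ≡ h w
mutH-off h v d w≢v rewrite ==V-false w≢v = refl

module MutableVertex (h : V → ℤ) (i j σ : ℤ) (σ-unit : IsUnit σ) (stepped : Stepped h)
  (hE : h (i + 1ℤ , j) ≡ h (i , j) + σ) (hW : h (i - 1ℤ , j) ≡ h (i , j) + σ)
  (hN : h (i , j + 1ℤ) ≡ h (i , j) + σ) (hS : h (i , j - 1ℤ) ≡ h (i , j) + σ) where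

  v : V
  v = (i , j)

  k : ℤ
  k = h v

  h' : V → ℤ
  h' = mutH h v (σ + σ)

  τ₁ τ₂ τ₃ τ₄ : ℤ
  τ₁ = h (i + 1ℤ , j + 1ℤ) - h (i + 1ℤ , j)
  τ₂ = h (i - 1ℤ , j + 1ℤ) - h (i - 1ℤ , j)
  τ₃ = h (i + 1ℤ , j - 1ℤ) - h (i + 1ℤ , j)
  τ₄ = h (i - 1ℤ , j - 1ℤ) - h (i - 1ℤ , j)

  private
    below-unit : ∀ x → IsUnit (h (x , j - 1ℤ) - h (x , j))
    below-unit x = unit-swap {h (x , j)} (subst (λ t → IsUnit (h (x , t) - h (x , j - 1ℤ))) (pred-succ j)
                                    (proj₂ (stepped x (j - 1ℤ))))
      where pred-succ : ∀ j → (j - 1ℤ) + 1ℤ ≡ j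
            pred-succ = solve-∀

  τ₁-unit : IsUnit τ₁
  τ₁-unit = proj₂ (stepped (i + 1ℤ) j)
  τ₂-unit : IsUnit τ₂
  τ₂-unit = proj₂ (stepped (i - 1ℤ) j)
  τ₃-unit : IsUnit τ₃
  τ₃-unit = below-unit (i + 1ℤ)
  τ₄-unit : IsUnit τ₄
  τ₄-unit = below-unit (i - 1ℤ)

  block block′ : ℤ → ℤ → ℤ
  block  = blockHeights 0ℤ σ τ₁ τ₂ τ₃ τ₄
  block′ = blockHeights (σ + σ) σ τ₁ τ₂ τ₃ τ₄

  private
    corner : ∀ {p q} → h q ≡ k + σ → h p ≡ k + (σ + (h p - h q))
    corner {p} hq = trans (sym (add-back (h p) k σ)) (cong (λ t → k + (σ + (h p - t))) (sym hq))
      where add-back : ∀ P k σ → k + (σ + (P - (k + σ))) ≡ P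
            add-back = solve-∀

    straight : ∀ {p q} → p ≡ q → h q ≡ k + σ → h p ≡ k + σ
    straight p≡q = trans (cong h p≡q)

  around-block : OnBlock (around h v) k block
  around-block -1∈ -1∈ = corner hW
  around-block -1∈ 0∈  = straight (cong (i - 1ℤ ,_) (ℤP.+-identityʳ j)) hW
  around-block -1∈ 1∈  = corner hW
  around-block 0∈  -1∈ = straight (cong (_, j - 1ℤ) (ℤP.+-identityʳ i)) hS
  around-block 0∈  0∈  = trans (cong h (origin-shift i j)) (sym (ℤP.+-identityʳ k))
  around-block 0∈  1∈  = straight (cong (_, j + 1ℤ) (ℤP.+-identityʳ i)) hN
  around-block 1∈  -1∈ = corner hE
  around-block 1∈  0∈  = straight (cong (i + 1ℤ ,_) (ℤP.+-identityʳ j)) hE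
  around-block 1∈  1∈  = corner hE

  lowered : ∀ k σ → (k + σ) - (k + (σ + σ)) ≡ - σ
  lowered = solve-∀

  raised : ∀ k σ → (k + (σ + σ)) - (k + σ) ≡ σ
  raised = solve-∀

  h'-at : h' v ≡ k + (σ + σ)
  h'-at = mutH-at h v (σ + σ)

  h'-off : ∀ {w} → w ≢ v → h' w ≡ h w
  h'-off = mutH-off h v (σ + σ)

  around-block′ : OnBlock (around h' v) k block′
  around-block′ {x} {y} x∈ y∈ = trans (around-mutH h i j (σ + σ) x y) (moved x∈ y∈)
    where
    moved : x ∈ offsets → y ∈ offsets →
            (if isOrigin x y then k + (σ + σ) else around h v x y) ≡ k + block′ x y
    moved x∈@-1∈ y∈@-1∈ = around-block x∈ y∈
    moved x∈@-1∈ y∈@0∈  = around-block x∈ y∈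
    moved x∈@-1∈ y∈@1∈  = around-block x∈ y∈
    moved x∈@0∈  y∈@-1∈ = around-block x∈ y∈
    moved 0∈     0∈     = refl
    moved x∈@0∈  y∈@1∈  = around-block x∈ y∈
    moved x∈@1∈  y∈@-1∈ = around-block x∈ y∈
    moved x∈@1∈  y∈@0∈  = around-block x∈ y∈
    moved x∈@1∈  y∈@1∈  = around-block x∈ y∈

  private
    far-rule : ∀ a b a' b' → Far a b a' b' →
               mutateAtOrigin (exchangeOn (around h v)) a b a' b' ≡ exchangeOn (around h' v) a b a' b'
    far-rule a b a' b' = mutateAtOrigin-far (around h v) (around h' v) unmoved a b a' b'
      where
      unmoved : ∀ {x y} → isOrigin x y ≡ false → around h v x y ≡ around h' v x y
      unmoved {x} {y} o = sym (trans (around-mutH h i j (σ + σ) x y) (cong (if_then k + (σ + σ) else around h v x y) o))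

    local-rule : ∀ a b a' b' →
      mutateAtOrigin (exchangeOn (around h v)) a b a' b' ≡ exchangeOn (around h' v) a b a' b'
    local-rule a b a' b' with near-or-distant a | near-or-distant b | near-or-distant a' | near-or-distant b'
    ... | inj₁ a∈ | inj₁ b∈ | inj₁ a'∈ | inj₁ b'∈ = begin
      mutateAtOrigin (exchangeOn (around h v)) a b a' b'
        ≡⟨ mutateAtOrigin-block {k = k} around-block a∈ b∈ a'∈ b'∈ ⟩
      mutateAtOrigin (exchangeOn block) a b a' b'
        ≡⟨ block-mutation σ-unit τ₁-unit τ₂-unit τ₃-unit τ₄-unit a∈ b∈ a'∈ b'∈ ⟩
      exchangeOn block′ a b a' b'
        ≡⟨ sym (exchangeOn-block {k = k} around-block′ a∈ b∈ a'∈ b'∈) ⟩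
      exchangeOn (around h' v) a b a' b' ∎
      where open ≡-Reasoning
    ... | inj₂ d | _ | _ | _ = far-rule a b a' b' (inj₁ (inj₁ d))
    ... | inj₁ _ | inj₂ d | _ | _ = far-rule a b a' b' (inj₁ (inj₂ d))
    ... | inj₁ _ | inj₁ _ | inj₂ d | _ = far-rule a b a' b' (inj₂ (inj₁ d))
    ... | inj₁ _ | inj₁ _ | inj₁ _ | inj₂ d = far-rule a b a' b' (inj₂ (inj₂ d))

  exchange-mutation : ∀ u w → mutB (exchange h) v u w ≡ exchange h' u w
  exchange-mutation u w =
    subst₂ (λ u w → mutB (exchange h) v u w ≡ exchange h' u w) (sym (decompose i j u)) (sym (decompose i j w))
      (trans (mutB-around h i j a b a' b') (trans (local-rule a b a' b') (sym (exchange-around h' i j a b a' b'))))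
    where
    a = proj₁ u - i
    b = proj₂ u - j
    a' = proj₁ w - i
    b' = proj₂ w - j

  private

    moved-unit : ∀ p q → IsUnit (h q - h p) →
      (p ≡ v → q ≢ v × h q ≡ k + σ) → (q ≡ v → p ≢ v × h p ≡ k + σ) → IsUnit (h' q - h' p)
    moved-unit p q u at-p at-q with p ≟V v | q ≟V v
    ... | yes refl | _ = subst IsUnit (sym (begin
      h' q - h' v     ≡⟨ cong₂ _-_ (trans (h'-off (proj₁ (at-p refl))) (proj₂ (at-p refl))) h'-at ⟩
      (k + σ) - (k + (σ + σ)) ≡⟨ lowered k σ ⟩
      - σ             ∎)) (unit-neg σ-unit)
      where open ≡-Reasoning
    ... | no p≢v | yes refl = subst IsUnit (sym (begin
      h' v - h' p     ≡⟨ cong₂ _-_ h'-at (trans (h'-off p≢v) (proj₂ (at-q refl))) ⟩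
      (k + (σ + σ)) - (k + σ) ≡⟨ raised k σ ⟩
      σ               ∎)) σ-unit
      where open ≡-Reasoning
    ... | no p≢v | no q≢v = subst IsUnit (sym (cong₂ _-_ (h'-off q≢v) (h'-off p≢v))) u

  stepped′ : Stepped h'
  stepped′ x y = moved-unit (x , y) (x + 1ℤ , y) (proj₁ (stepped x y)) east-of west-of
               , moved-unit (x , y) (x , y + 1ℤ) (proj₂ (stepped x y)) north-of south-of
    where
    east-of : (x , y) ≡ v → (x + 1ℤ , y) ≢ v × h (x + 1ℤ , y) ≡ k + σ
    east-of refl = fst≢ (succ≢ i) , hE
    west-of : (x + 1ℤ , y) ≡ v → (x , y) ≢ v × h (x , y) ≡ k + σ
    west-of eq = subst (λ p → p ≢ v × h p ≡ k + σ) (sym (cong₂ _,_ (unshift 1ℤ (cong proj₁ eq)) (cong proj₂ eq)))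
                       (fst≢ (pred≢ i) , hW)
    north-of : (x , y) ≡ v → (x , y + 1ℤ) ≢ v × h (x , y + 1ℤ) ≡ k + σ
    north-of refl = snd≢ (succ≢ j) , hN
    south-of : (x , y + 1ℤ) ≡ v → (x , y) ≢ v × h (x , y) ≡ k + σ
    south-of eq = subst (λ p → p ≢ v × h p ≡ k + σ) (sym (cong₂ _,_ (cong proj₁ eq) (unshift 1ℤ (cong proj₂ eq))))
                        (snd≢ (pred≢ j) , hS)

  exchange-from-v : ∀ a b → exchange h v (i + a , j + b) ≡ exchangeOn block 0ℤ 0ℤ a b
  exchange-from-v a b = trans (exchange-from-centre h i j a b) (row (near-or-distant a) (near-or-distant b))
    where
    row : a ∈ offsets ⊎ Distant a → b ∈ offsets ⊎ Distant b →
          exchangeOn (around h v) 0ℤ 0ℤ a b ≡ exchangeOn block 0ℤ 0ℤ a b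
    row (inj₁ a∈) (inj₁ b∈) = exchangeOn-block {k = k} around-block 0∈ 0∈ a∈ b∈
    row (inj₂ d)  _         = trans (exchangeOn-from-origin (around h v) a b (inj₁ d))
                                    (sym (exchangeOn-from-origin block a b (inj₁ d)))
    row (inj₁ _)  (inj₂ d)  = trans (exchangeOn-from-origin (around h v) a b (inj₂ d))
                                    (sym (exchangeOn-from-origin block a b (inj₂ d)))

  private
    horizontal : (0ℤ - σ) + 0ℤ ≡ - σ
    horizontal = trans (ℤP.+-identityʳ _) (ℤP.+-identityˡ _)
    vertical : (σ - 0ℤ) + 0ℤ ≡ σ
    vertical = trans (ℤP.+-identityʳ _) (ℤP.+-identityʳ σ)

  exchange-east : exchange h v (i + 1ℤ , j) ≡ - σ
  exchange-east = trans (cong (λ t → exchange h v (i + 1ℤ , t)) (sym (ℤP.+-identityʳ j)))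
                        (trans (exchange-from-v 1ℤ 0ℤ) horizontal)

  exchange-west : exchange h v (i - 1ℤ , j) ≡ - σ
  exchange-west = trans (cong (λ t → exchange h v (i - 1ℤ , t)) (sym (ℤP.+-identityʳ j)))
                        (trans (exchange-from-v -1ℤ 0ℤ) horizontal)

  exchange-north : exchange h v (i , j + 1ℤ) ≡ σ
  exchange-north = trans (cong (λ t → exchange h v (t , j + 1ℤ)) (sym (ℤP.+-identityʳ i)))
                         (trans (exchange-from-v 0ℤ 1ℤ) vertical)

  exchange-south : exchange h v (i , j - 1ℤ) ≡ σ
  exchange-south = trans (cong (λ t → exchange h v (t , j - 1ℤ)) (sym (ℤP.+-identityʳ i)))
                         (trans (exchange-from-v 0ℤ -1ℤ) vertical)

  NotAdjacent : V → Set
  NotAdjacent w = w ≢ v × w ≢ (i + 1ℤ , j) × w ≢ (i - 1ℤ , j) × w ≢ (i , j + 1ℤ) × w ≢ (i , j - 1ℤ)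

  exchange-elsewhere : ∀ w → NotAdjacent w → exchange h v w ≡ 0ℤ
  exchange-elsewhere w not-adj =
    trans (cong (exchange h v) (decompose i j w))
          (trans (exchange-from-v a b)
                 (vanishes (near-or-distant a) (near-or-distant b) (subst NotAdjacent (decompose i j w) not-adj)))
    where
    a = proj₁ w - i
    b = proj₂ w - j
    vanishes : ∀ {a b} → a ∈ offsets ⊎ Distant a → b ∈ offsets ⊎ Distant b → NotAdjacent (i + a , j + b) →
               exchangeOn block 0ℤ 0ℤ a b ≡ 0ℤ
    vanishes {a} {b} (inj₂ d) _ _ = exchangeOn-from-origin block a b (inj₁ d)
    vanishes {a} {b} (inj₁ _) (inj₂ d) _ = exchangeOn-from-origin block a b (inj₂ d)
    vanishes (inj₁ 0∈) (inj₁ 0∈) (≢v , _) = ⊥-elim (≢v (origin-shift i j))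
    vanishes (inj₁ 1∈) (inj₁ 0∈) (_ , ≢E , _) =
      ⊥-elim (≢E (cong (i + 1ℤ ,_) (ℤP.+-identityʳ j)))
    vanishes (inj₁ -1∈) (inj₁ 0∈) (_ , _ , ≢W , _) =
      ⊥-elim (≢W (cong (i - 1ℤ ,_) (ℤP.+-identityʳ j)))
    vanishes (inj₁ 0∈) (inj₁ 1∈) (_ , _ , _ , ≢N , _) =
      ⊥-elim (≢N (cong (_, j + 1ℤ) (ℤP.+-identityʳ i)))
    vanishes (inj₁ 0∈) (inj₁ -1∈) (_ , _ , _ , _ , ≢S) =
      ⊥-elim (≢S (cong (_, j - 1ℤ) (ℤP.+-identityʳ i)))
    vanishes (inj₁ -1∈) (inj₁ -1∈) _ rewrite ℤP.+-inverseʳ σ = refl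
    vanishes (inj₁ -1∈) (inj₁ 1∈) _ rewrite ℤP.+-inverseʳ σ = refl
    vanishes (inj₁ 1∈) (inj₁ -1∈) _ rewrite ℤP.+-inverseʳ σ = refl
    vanishes (inj₁ 1∈) (inj₁ 1∈) _ rewrite ℤP.+-inverseʳ σ = refl

record Invariant (s : Seed) : Set where
  field
    stepped       : Stepped (height s)
    B≡exchange    : ∀ u w → B s u w ≡ exchange (height s) u w
    y≈coefficient : ∀ w → y s w ≈ coefficient (height s) w

mutB-cong : ∀ {b b'} v → (∀ u w → b u w ≡ b' u w) → ∀ u w → mutB b v u w ≡ mutB b' v u w
mutB-cong v b≡b' u w rewrite b≡b' u w | b≡b' u v | b≡b' v w = refl

module CoefficientMutation (s : Seed) (i j σ : ℤ) (σ-unit : IsUnit σ) (inv : Invariant s)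
  (hE : height s (i + 1ℤ , j) ≡ height s (i , j) + σ) (hW : height s (i - 1ℤ , j) ≡ height s (i , j) + σ)
  (hN : height s (i , j + 1ℤ) ≡ height s (i , j) + σ) (hS : height s (i , j - 1ℤ) ≡ height s (i , j) + σ) where

  open Invariant inv
  open MutableVertex (height s) i j σ σ-unit stepped hE hW hN hS public

  private
    h = height s

    dropped : ∀ k σ → k - (k + σ) ≡ - σ
    dropped = solve-∀
    risen : ∀ k σ → (k + σ) - k ≡ σ
    risen = solve-∀

    unmoved : ∀ {q w} → q ≢ v → w ≢ v → h' q - h' w ≡ h q - h w
    unmoved q≢v w≢v = cong₂ _-_ (h'-off q≢v) (h'-off w≢v)

    new-toward-v : ∀ {q w} → q ≡ v → w ≢ v → h w ≡ k + σ → h' q - h' w ≡ σ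
    new-toward-v refl w≢v hw = trans (cong₂ _-_ h'-at (trans (h'-off w≢v) hw)) (raised k σ)

    old-toward-v : ∀ {q w} → q ≡ v → h w ≡ k + σ → h q - h w ≡ - σ
    old-toward-v refl hw = trans (cong (λ t → k - t) hw) (dropped k σ)

    from-v : ∀ {w} → h w ≡ k + σ → h w - k ≡ σ
    from-v hw = trans (cong (_- k) hw) (risen k σ)

  y-at-v : y s v ≈ (J i j (k + σ) ÷ I i j (k + σ)) ^ σ
  y-at-v p = trans (y≈coefficient v p)
    (trans (yBelow-cong i j {k} refl (from-v hS) (from-v hN) (from-v hW) (from-v hE) p)
           (yBelow-uniform i j k σ-unit p))

  private
    increments : increment σ (y s v) ≈ J i j (k + σ) ^ σ × increment (- σ) (y s v) ≈ I i j (k + σ) ^ (- σ)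
    increments = increment-ratio-power σ-unit (J-nonnegative i j (k + σ)) (I-nonnegative i j (k + σ))
                   (swap (I-or-J-trivial i j (k + σ))) y-at-v

    at-neighbour : ∀ w {b δ} → w ≢ v → B s v w ≡ b → increment b (y s v) ≈ δ →
                   coefficient h' w ≈ coefficient h w · δ → mutY (B s) (y s) v w ≈ coefficient h' w
    at-neighbour w {b} {δ} w≢v b≡ increment≈ formula p = begin
      mutY (B s) (y s) v w p                  ≡⟨ mutY-elsewhere (B s) (y s) v w w≢v p ⟩
      y s w p + increment (B s v w) (y s v) p ≡⟨ cong₂ _+ℤ_ (y≈coefficient w p)
                                                   (trans (cong (λ b → increment b (y s v) p) b≡) (increment≈ p)) ⟩
      coefficient h w p + δ p                 ≡⟨ sym (formula p) ⟩
      coefficient h' w p                      ∎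
      where open ≡-Reasoning

    succ-pred : ∀ x → (x + 1ℤ) - 1ℤ ≡ x
    succ-pred = solve-∀
    pred-succ : ∀ x → (x - 1ℤ) + 1ℤ ≡ x
    pred-succ = solve-∀

    coefficient-east : coefficient h' (i + 1ℤ , j) ≈ coefficient h (i + 1ℤ , j) · (I i j (k + σ) ^ (- σ))
    coefficient-east p = begin
      coefficient h' (i + 1ℤ , j) p
        ≡⟨ yBelow-cong (i + 1ℤ) j (h'-off (off {j})) (unmoved off off) (unmoved off off)
                       (new-toward-v at-v off hE) (unmoved (fst≢ (succ²≢ i)) off) p ⟩
      yBelow (i + 1ℤ) j (h (i + 1ℤ , j)) e₁ e₂ σ e₄ p
        ≡⟨ yBelow-flip₃ (i + 1ℤ) j (h (i + 1ℤ , j)) p e₁ e₂ σ e₄ ⟩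
      yBelow (i + 1ℤ) j (h (i + 1ℤ , j)) e₁ e₂ (- σ) e₄ p + - σ * I ((i + 1ℤ) - 1ℤ) j (h (i + 1ℤ , j)) p
        ≡⟨ cong₂ _+ℤ_
            (cong (λ e → yBelow (i + 1ℤ) j (h (i + 1ℤ , j)) e₁ e₂ e e₄ p) (sym (old-toward-v at-v hE)))
            (cong₂ (λ a m → - σ * I a j m p) (succ-pred i) hE) ⟩
      coefficient h (i + 1ℤ , j) p + - σ * I i j (k + σ) p ∎
      where
      open ≡-Reasoning
      off : ∀ {b} → (i + 1ℤ , b) ≢ v
      off = fst≢ (succ≢ i)
      at-v : ((i + 1ℤ) - 1ℤ , j) ≡ v
      at-v = cong (_, j) (succ-pred i)
      e₁ = h (i + 1ℤ , j - 1ℤ) - h (i + 1ℤ , j)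
      e₂ = h (i + 1ℤ , j + 1ℤ) - h (i + 1ℤ , j)
      e₄ = h ((i + 1ℤ) + 1ℤ , j) - h (i + 1ℤ , j)

    coefficient-west : coefficient h' (i - 1ℤ , j) ≈ coefficient h (i - 1ℤ , j) · (I i j (k + σ) ^ (- σ))
    coefficient-west p = begin
      coefficient h' (i - 1ℤ , j) p
        ≡⟨ yBelow-cong (i - 1ℤ) j (h'-off (off {j})) (unmoved off off) (unmoved off off)
                       (unmoved (fst≢ (pred²≢ i)) off) (new-toward-v at-v off hW) p ⟩
      yBelow (i - 1ℤ) j (h (i - 1ℤ , j)) e₁ e₂ e₃ σ p
        ≡⟨ yBelow-flip₄ (i - 1ℤ) j (h (i - 1ℤ , j)) p e₁ e₂ e₃ σ ⟩
      yBelow (i - 1ℤ) j (h (i - 1ℤ , j)) e₁ e₂ e₃ (- σ) p + - σ * I ((i - 1ℤ) + 1ℤ) j (h (i - 1ℤ , j)) p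
        ≡⟨ cong₂ _+ℤ_
            (cong (λ e → yBelow (i - 1ℤ) j (h (i - 1ℤ , j)) e₁ e₂ e₃ e p) (sym (old-toward-v at-v hW)))
            (cong₂ (λ a m → - σ * I a j m p) (pred-succ i) hW) ⟩
      coefficient h (i - 1ℤ , j) p + - σ * I i j (k + σ) p ∎
      where
      open ≡-Reasoning
      off : ∀ {b} → (i - 1ℤ , b) ≢ v
      off = fst≢ (pred≢ i)
      at-v : ((i - 1ℤ) + 1ℤ , j) ≡ v
      at-v = cong (_, j) (pred-succ i)
      e₁ = h (i - 1ℤ , j - 1ℤ) - h (i - 1ℤ , j)
      e₂ = h (i - 1ℤ , j + 1ℤ) - h (i - 1ℤ , j)
      e₃ = h ((i - 1ℤ) - 1ℤ , j) - h (i - 1ℤ , j)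

    coefficient-north : coefficient h' (i , j + 1ℤ) ≈ coefficient h (i , j + 1ℤ) · (J i j (k + σ) ^ σ)
    coefficient-north p = begin
      coefficient h' (i , j + 1ℤ) p
        ≡⟨ yBelow-cong i (j + 1ℤ) (h'-off (off {i})) (new-toward-v at-v off hN) (unmoved (snd≢ (succ²≢ j)) off)
                       (unmoved off off) (unmoved off off) p ⟩
      yBelow i (j + 1ℤ) (h (i , j + 1ℤ)) σ e₂ e₃ e₄ p
        ≡⟨ yBelow-flip₁ i (j + 1ℤ) (h (i , j + 1ℤ)) p σ e₂ e₃ e₄ ⟩
      yBelow i (j + 1ℤ) (h (i , j + 1ℤ)) (- σ) e₂ e₃ e₄ p + σ * J i ((j + 1ℤ) - 1ℤ) (h (i , j + 1ℤ)) p
        ≡⟨ cong₂ _+ℤ_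
            (cong (λ e → yBelow i (j + 1ℤ) (h (i , j + 1ℤ)) e e₂ e₃ e₄ p) (sym (old-toward-v at-v hN)))
            (cong₂ (λ b m → σ * J i b m p) (succ-pred j) hN) ⟩
      coefficient h (i , j + 1ℤ) p + σ * J i j (k + σ) p ∎
      where
      open ≡-Reasoning
      off : ∀ {a} → (a , j + 1ℤ) ≢ v
      off = snd≢ (succ≢ j)
      at-v : (i , (j + 1ℤ) - 1ℤ) ≡ v
      at-v = cong (i ,_) (succ-pred j)
      e₂ = h (i , (j + 1ℤ) + 1ℤ) - h (i , j + 1ℤ)
      e₃ = h (i - 1ℤ , j + 1ℤ) - h (i , j + 1ℤ)
      e₄ = h (i + 1ℤ , j + 1ℤ) - h (i , j + 1ℤ)

    coefficient-south : coefficient h' (i , j - 1ℤ) ≈ coefficient h (i , j - 1ℤ) · (J i j (k + σ) ^ σ)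
    coefficient-south p = begin
      coefficient h' (i , j - 1ℤ) p
        ≡⟨ yBelow-cong i (j - 1ℤ) (h'-off (off {i})) (unmoved (snd≢ (pred²≢ j)) off) (new-toward-v at-v off hS)
                       (unmoved off off) (unmoved off off) p ⟩
      yBelow i (j - 1ℤ) (h (i , j - 1ℤ)) e₁ σ e₃ e₄ p
        ≡⟨ yBelow-flip₂ i (j - 1ℤ) (h (i , j - 1ℤ)) p e₁ σ e₃ e₄ ⟩
      yBelow i (j - 1ℤ) (h (i , j - 1ℤ)) e₁ (- σ) e₃ e₄ p + σ * J i ((j - 1ℤ) + 1ℤ) (h (i , j - 1ℤ)) p
        ≡⟨ cong₂ _+ℤ_
            (cong (λ e → yBelow i (j - 1ℤ) (h (i , j - 1ℤ)) e₁ e e₃ e₄ p) (sym (old-toward-v at-v hS)))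
            (cong₂ (λ b m → σ * J i b m p) (pred-succ j) hS) ⟩
      coefficient h (i , j - 1ℤ) p + σ * J i j (k + σ) p ∎
      where
      open ≡-Reasoning
      off : ∀ {a} → (a , j - 1ℤ) ≢ v
      off = snd≢ (pred≢ j)
      at-v : (i , (j - 1ℤ) + 1ℤ) ≡ v
      at-v = cong (i ,_) (pred-succ j)
      e₁ = h (i , (j - 1ℤ) - 1ℤ) - h (i , j - 1ℤ)
      e₃ = h (i - 1ℤ , j - 1ℤ) - h (i , j - 1ℤ)
      e₄ = h (i + 1ℤ , j - 1ℤ) - h (i , j - 1ℤ)

    settle : ∀ k σ → (k + (σ + σ)) + - σ ≡ k + σ
    settle = solve-∀

    coefficient-at-v : mutY (B s) (y s) v v ≈ coefficient h' v
    coefficient-at-v p = begin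
      mutY (B s) (y s) v v p
        ≡⟨ mutY-here (B s) (y s) v p ⟩
      - y s v p
        ≡⟨ cong -_ (y-at-v p) ⟩
      - (σ * (J i j (k + σ) p + - I i j (k + σ) p))
        ≡⟨ ℤP.neg-distribˡ-* σ _ ⟩
      - σ * (J i j (k + σ) p + - I i j (k + σ) p)
        ≡⟨ cong (λ m → - σ * (J i j m p + - I i j m p)) (sym (settle k σ)) ⟩
      ((J i j (k + (σ + σ) + - σ) ÷ I i j (k + (σ + σ) + - σ)) ^ (- σ)) p
        ≡⟨ sym (yBelow-uniform i j (k + (σ + σ)) (unit-neg σ-unit) p) ⟩
      yBelow i j (k + (σ + σ)) (- σ) (- σ) (- σ) (- σ) p
        ≡⟨ sym (yBelow-cong i j h'-at (toward (snd≢ (pred≢ j)) hS) (toward (snd≢ (succ≢ j)) hN)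
                                      (toward (fst≢ (pred≢ i)) hW) (toward (fst≢ (succ≢ i)) hE) p) ⟩
      coefficient h' v p ∎
      where
      open ≡-Reasoning
      toward : ∀ {w} → w ≢ v → h w ≡ k + σ → h' w - h' v ≡ - σ
      toward w≢v hw = trans (cong₂ _-_ (trans (h'-off w≢v) hw) h'-at) (lowered k σ)

    coefficient-unmoved : ∀ w → NotAdjacent w → coefficient h' w ≈ coefficient h w
    coefficient-unmoved (x , y') (w≢v , ≢E , ≢W , ≢N , ≢S) =
      yBelow-cong x y' (h'-off w≢v) (unmoved S≢v w≢v) (unmoved N≢v w≢v) (unmoved W≢v w≢v) (unmoved E≢v w≢v)
      where
      S≢v : (x , y' - 1ℤ) ≢ v
      S≢v eq = ≢N (cong₂ _,_ (cong proj₁ eq) (unshift -1ℤ (cong proj₂ eq)))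
      N≢v : (x , y' + 1ℤ) ≢ v
      N≢v eq = ≢S (cong₂ _,_ (cong proj₁ eq) (unshift 1ℤ (cong proj₂ eq)))
      W≢v : (x - 1ℤ , y') ≢ v
      W≢v eq = ≢E (cong₂ _,_ (unshift -1ℤ (cong proj₁ eq)) (cong proj₂ eq))
      E≢v : (x + 1ℤ , y') ≢ v
      E≢v eq = ≢W (cong₂ _,_ (unshift 1ℤ (cong proj₁ eq)) (cong proj₂ eq))

    coefficient-elsewhere : ∀ w → NotAdjacent w → mutY (B s) (y s) v w ≈ coefficient h' w
    coefficient-elsewhere w not-adjacent p = begin
      mutY (B s) (y s) v w p
        ≡⟨ mutY-elsewhere (B s) (y s) v w (proj₁ not-adjacent) p ⟩
      y s w p + increment (B s v w) (y s v) p
        ≡⟨ cong (λ b → y s w p + increment b (y s v) p)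
                (trans (B≡exchange v w) (exchange-elsewhere w not-adjacent)) ⟩
      y s w p + 0ℤ
        ≡⟨ ℤP.+-identityʳ _ ⟩
      y s w p
        ≡⟨ y≈coefficient w p ⟩
      coefficient h w p
        ≡⟨ sym (coefficient-unmoved w not-adjacent p) ⟩
      coefficient h' w p ∎
      where open ≡-Reasoning

  coefficient-mutation : ∀ w → mutY (B s) (y s) v w ≈ coefficient h' w
  coefficient-mutation w with w ≟V v
  ... | yes refl = coefficient-at-v
  ... | no w≢v with w ≟V (i + 1ℤ , j)
  ... | yes refl = at-neighbour w w≢v (trans (B≡exchange v w) exchange-east) (proj₂ increments) coefficient-east
  ... | no w≢E with w ≟V (i - 1ℤ , j)
  ... | yes refl = at-neighbour w w≢v (trans (B≡exchange v w) exchange-west) (proj₂ increments) coefficient-west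
  ... | no w≢W with w ≟V (i , j + 1ℤ)
  ... | yes refl = at-neighbour w w≢v (trans (B≡exchange v w) exchange-north) (proj₁ increments) coefficient-north
  ... | no w≢N with w ≟V (i , j - 1ℤ)
  ... | yes refl = at-neighbour w w≢v (trans (B≡exchange v w) exchange-south) (proj₁ increments) coefficient-south
  ... | no w≢S = coefficient-elsewhere w (w≢v , w≢E , w≢W , w≢N , w≢S)

mutation-invariant : ∀ {s i j σ} → IsUnit σ → Invariant s → NeighboursAt s (i , j) (height s (i , j) + σ) →
                     Invariant (mutate s (i , j) (σ + σ))
mutation-invariant {s} {i} {j} {σ} σ-unit inv (hE , hW , hN , hS) = record
  { stepped       = stepped′
  ; B≡exchange    = λ u w → trans (mutB-cong (i , j) (Invariant.B≡exchange inv) u w) (exchange-mutation u w)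
  ; y≈coefficient = coefficient-mutation
  }
  where open CoefficientMutation s i j σ σ-unit inv hE hW hN hS

-- The initial seed

parity : ℤ → ℕ
parity n = ∣ n ∣ % 2

toggle : ℕ → ℕ
toggle zero    = 1
toggle (suc _) = 0

parity-binary : ∀ n → parity n ≡ 0 ⊎ parity n ≡ 1
parity-binary n with parity n | m%n<n ∣ n ∣ 2
... | 0 | _ = inj₁ refl
... | 1 | _ = inj₂ refl
... | suc (suc _) | s≤s (s≤s ())

toggle-involutive : ∀ {π} → π < 2 → toggle (toggle π) ≡ π
toggle-involutive {0} _ = refl
toggle-involutive {1} _ = refl
toggle-involutive {suc (suc _)} (s≤s (s≤s ()))

%2-suc : ∀ m → suc m % 2 ≡ toggle (m % 2)
%2-suc 0             = refl
%2-suc 1             = refl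
%2-suc (suc (suc m)) = trans (%2-suc-suc (suc m)) (trans (%2-suc m) (cong toggle (sym (%2-suc-suc m))))
  where %2-suc-suc : ∀ m → suc (suc m) % 2 ≡ m % 2
        %2-suc-suc m = trans (cong (_% 2) (ℕP.+-comm 2 m)) ([m+n]%n≡m%n m 2)

parity-suc : ∀ n → parity (n + 1ℤ) ≡ toggle (parity n)
parity-suc (+ m)          = trans (cong (_% 2) (ℕP.+-comm m 1)) (%2-suc m)
parity-suc -[1+ 0 ]       = refl
parity-suc -[1+ suc m ]   = trans (sym (toggle-involutive (m%n<n (suc m) 2))) (cong toggle (sym (%2-suc (suc m))))

parity-pred : ∀ n → parity (n - 1ℤ) ≡ toggle (parity n)
parity-pred n = trans (sym (toggle-involutive (m%n<n ∣ n - 1ℤ ∣ 2)))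
                      (cong toggle (trans (sym (parity-suc (n - 1ℤ))) (cong parity (pred-succ n))))
  where pred-succ : ∀ n → (n - 1ℤ) + 1ℤ ≡ n
        pred-succ = solve-∀

heightOfParity : ℕ → ℤ
heightOfParity zero    = -1ℤ
heightOfParity (suc _) = 0ℤ

signOfParity : ℕ → ℤ
signOfParity zero    = 1ℤ
signOfParity (suc _) = -1ℤ

fund-parity : ∀ x y → fund (x , y) ≡ heightOfParity (parity (x + y))
fund-parity x y with parity (x + y)
... | zero  = refl
... | suc _ = refl

negOnePow-parity : ∀ n → negOnePow n ≡ signOfParity (parity n)
negOnePow-parity n with parity n
... | zero  = refl
... | suc _ = refl

toggleTimes : ℕ → ℕ → ℕ
toggleTimes zero    π = π
toggleTimes (suc m) π = toggle (toggleTimes m π)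

parity-shift : ∀ n d → parity (n + d) ≡ toggleTimes ∣ d ∣ (parity n)
parity-shift n (+ zero)        = cong parity (ℤP.+-identityʳ n)
parity-shift n (+ suc m)       = trans (cong parity (step-up n (+ m)))
                                       (trans (parity-suc (n + + m)) (cong toggle (parity-shift n (+ m))))
  where step-up : ∀ n m → n + (1ℤ + m) ≡ (n + m) + 1ℤ
        step-up = solve-∀
parity-shift n -[1+ zero ]     = parity-pred n
parity-shift n -[1+ suc m ]    = trans (cong parity (step-down n (+ m)))
                                       (trans (parity-pred (n + -[1+ m ])) (cong toggle (parity-shift n -[1+ m ])))
  where step-down : ∀ n m → n + - (1ℤ + (1ℤ + m)) ≡ (n + - (1ℤ + m)) - 1ℤ
        step-down = solve-∀

checkerboard : ℕ → ℤ → ℤ → ℤ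
checkerboard π x y = heightOfParity (toggleTimes ∣ x + y ∣ π)

around-fund : ∀ i j x y → around fund (i , j) x y ≡ checkerboard (parity (i + j)) x y
around-fund i j x y = trans (fund-parity (i + x) (j + y))
                            (cong heightOfParity (trans (cong parity (regroup i j x y)) (parity-shift (i + j) (x + y))))
  where regroup : ∀ i j x y → (i + x) + (j + y) ≡ (i + j) + (x + y)
        regroup = solve-∀

crossPattern : ℤ → ℤ → ℤ
crossPattern a b = δ a 1ℤ * δ b 0ℤ + δ a -1ℤ * δ b 0ℤ - δ a 0ℤ * δ b 1ℤ - δ a 0ℤ * δ b -1ℤ

δ-shift : ∀ i a t → δ (i + a) (i + t) ≡ δ a t
δ-shift i a t with a ℤ.≟ t
... | yes refl rewrite ==ℤ-true {i + a} refl = refl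
... | no a≢t rewrite ==ℤ-false {i + a} {i + t} (a≢t ∘ +-cancelˡ i) = refl

δ-shift₀ : ∀ i a → δ (i + a) i ≡ δ a 0ℤ
δ-shift₀ i a = trans (cong (δ (i + a)) (sym (ℤP.+-identityʳ i))) (δ-shift i a 0ℤ)

B₀-around : ∀ i j a b → B₀ (i + a , j + b) (i , j) ≡ signOfParity (parity (i + j)) * crossPattern a b
B₀-around i j a b
  rewrite negOnePow-parity (i + j) | δ-shift i a 1ℤ | δ-shift i a -1ℤ | δ-shift₀ i a
        | δ-shift₀ j b | δ-shift j b 1ℤ | δ-shift j b -1ℤ = refl

δ-distant : ∀ {a t} → Distant a → t ∈ offsets → δ a t ≡ 0ℤ
δ-distant {a} {t} d t∈ rewrite ==ℤ-false {a} {t} (λ { refl → near-not-distant t∈ d }) = refl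

crossPattern-distant : ∀ a b → Distant a ⊎ Distant b → crossPattern a b ≡ 0ℤ
crossPattern-distant a b (inj₁ d)
  rewrite δ-distant d -1∈ | δ-distant d 0∈ | δ-distant d 1∈ = refl
crossPattern-distant a b (inj₂ d)
  rewrite δ-distant d -1∈ | δ-distant d 0∈ | δ-distant d 1∈
        | ℤP.*-zeroʳ (δ a 1ℤ) | ℤP.*-zeroʳ (δ a -1ℤ) | ℤP.*-zeroʳ (δ a 0ℤ) = refl

parities : List ℕ
parities = 0 ∷ 1 ∷ []

parity∈parities : ∀ n → parity n ∈ parities
parity∈parities n with parity-binary n
... | inj₁ eq rewrite eq = here refl
... | inj₂ eq rewrite eq = there (here refl)

initialExchangeRule : ℕ × ℤ × ℤ → Bool
initialExchangeRule (π , a , b) = ⌊ signOfParity π * crossPattern a b ℤ.≟ exchangeOn (checkerboard π) a b 0ℤ 0ℤ ⌋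

initial-exchange-block : ∀ {π a b} → π ∈ parities → a ∈ offsets → b ∈ offsets →
                signOfParity π * crossPattern a b ≡ exchangeOn (checkerboard π) a b 0ℤ 0ℤ
initial-exchange-block π∈ a∈ b∈ =
  toWitness (lookup (all⁺ initialExchangeRule (parities ⊗ offsets ⊗ offsets) _)
                    (∈-cartesianProduct⁺ π∈ (∈-cartesianProduct⁺ a∈ b∈)))

initial-exchange : ∀ u w → B₀ u w ≡ exchange fund u w
initial-exchange u (i , j) =
  subst (λ u → B₀ u (i , j) ≡ exchange fund u (i , j)) (sym (decompose i j u))
        (column (proj₁ u - i) (proj₂ u - j))
  where
  π = parity (i + j)

  block-or-far : ∀ {a b} → a ∈ offsets ⊎ Distant a → b ∈ offsets ⊎ Distant b →
                 signOfParity π * crossPattern a b ≡ exchangeOn (checkerboard π) a b 0ℤ 0ℤ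
  block-or-far (inj₁ a∈) (inj₁ b∈) = initial-exchange-block (parity∈parities (i + j)) a∈ b∈
  block-or-far {a} {b} (inj₂ d) _ =
    trans (cong (signOfParity π *_) (crossPattern-distant a b (inj₁ d)))
          (trans (ℤP.*-zeroʳ (signOfParity π)) (sym (exchangeOn-to-origin (checkerboard π) a b (inj₁ d))))
  block-or-far {a} {b} (inj₁ _) (inj₂ d) =
    trans (cong (signOfParity π *_) (crossPattern-distant a b (inj₂ d)))
          (trans (ℤP.*-zeroʳ (signOfParity π)) (sym (exchangeOn-to-origin (checkerboard π) a b (inj₂ d))))

  column : ∀ a b → B₀ (i + a , j + b) (i , j) ≡ exchange fund (i + a , j + b) (i , j)
  column a b = begin
    B₀ (i + a , j + b) (i , j)                  ≡⟨ B₀-around i j a b ⟩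
    signOfParity π * crossPattern a b           ≡⟨ block-or-far (near-or-distant a) (near-or-distant b) ⟩
    exchangeOn (checkerboard π) a b 0ℤ 0ℤ       ≡⟨ sym (exchangeOn-cong (around-fund i j) a b 0ℤ 0ℤ) ⟩
    exchangeOn (around fund (i , j)) a b 0ℤ 0ℤ  ≡⟨ sym (exchange-to-centre fund i j a b) ⟩
    exchange fund (i + a , j + b) (i , j)       ∎
    where open ≡-Reasoning

fund-shift : ∀ x y {a b x' y'} → x' ≡ x + a → y' ≡ y + b → fund (x' , y') ≡ checkerboard (parity (x + y)) a b
fund-shift x y {a} {b} refl refl = around-fund x y a b

fund-east : ∀ x y → fund (x + 1ℤ , y) ≡ heightOfParity (toggle (parity (x + y)))
fund-east x y = fund-shift x y {1ℤ} {0ℤ} refl (sym (ℤP.+-identityʳ y))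

fund-west : ∀ x y → fund (x - 1ℤ , y) ≡ heightOfParity (toggle (parity (x + y)))
fund-west x y = fund-shift x y { -1ℤ} {0ℤ} refl (sym (ℤP.+-identityʳ y))

fund-north : ∀ x y → fund (x , y + 1ℤ) ≡ heightOfParity (toggle (parity (x + y)))
fund-north x y = fund-shift x y {0ℤ} {1ℤ} (sym (ℤP.+-identityʳ x)) refl

fund-south : ∀ x y → fund (x , y - 1ℤ) ≡ heightOfParity (toggle (parity (x + y)))
fund-south x y = fund-shift x y {0ℤ} { -1ℤ} (sym (ℤP.+-identityʳ x)) refl

parity-step : ∀ π → IsUnit (heightOfParity (toggle π) - heightOfParity π)
parity-step zero    = inj₁ refl
parity-step (suc _) = inj₂ refl

initial-stepped : Stepped fund
initial-stepped x y =
  subst IsUnit (sym (cong₂ _-_ (fund-east x y) (fund-parity x y))) (parity-step (parity (x + y))) ,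
  subst IsUnit (sym (cong₂ _-_ (fund-north x y) (fund-parity x y))) (parity-step (parity (x + y)))

initial-coefficient : ∀ i j → c i j ≈ coefficient fund (i , j)
initial-coefficient i j p = sym (begin
  coefficient fund (i , j) p
    ≡⟨ yBelow-cong i j (fund-parity i j) (step (fund-south i j)) (step (fund-north i j))
                                         (step (fund-west i j)) (step (fund-east i j)) p ⟩
  yBelow i j (heightOfParity π) σ σ σ σ p
    ≡⟨ yBelow-uniform i j (heightOfParity π) (parity-step π) p ⟩
  ((J i j (heightOfParity π + σ) ÷ I i j (heightOfParity π + σ)) ^ σ) p
    ≡⟨ generator (parity-binary (i + j)) ⟩
  c i j p ∎)
  where
  open ≡-Reasoning
  π = parity (i + j)
  σ = heightOfParity (toggle π) - heightOfParity π

  step : ∀ {x} → x ≡ heightOfParity (toggle π) → x - fund (i , j) ≡ σ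
  step e = cong₂ _-_ e (fund-parity i j)

  generator : ∀ {π} → π ≡ 0 ⊎ π ≡ 1 →
    let σ = heightOfParity (toggle π) - heightOfParity π in
    ((J i j (heightOfParity π + σ) ÷ I i j (heightOfParity π + σ)) ^ σ) p ≡ c i j p
  generator (inj₁ refl) rewrite ℤP.+-identityʳ j = simplify (c i j p)
    where simplify : ∀ x → 1ℤ * ((x + 0ℤ) + - 0ℤ) ≡ x
          simplify = solve-∀
  generator (inj₂ refl) rewrite ℤP.+-identityʳ i = simplify (c i j p)
    where simplify : ∀ x → -1ℤ * (0ℤ + - (x + 0ℤ)) ≡ x
          simplify = solve-∀

initial-invariant : Invariant initialSeed
initial-invariant = record
  { stepped       = initial-stepped
  ; B≡exchange    = initial-exchange
  ; y≈coefficient = λ { (i , j) → initial-coefficient i j }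
  }

reachable-invariant : ∀ {s} → Reachable s → Invariant s
reachable-invariant init            = initial-invariant
reachable-invariant (down _ r nbrs) = mutation-invariant (inj₂ refl) (reachable-invariant r) nbrs
reachable-invariant (up   _ r nbrs) = mutation-invariant (inj₁ refl) (reachable-invariant r) nbrs

proposition3p3 : (s : Seed) → Reachable s →
    (i j k ε₁ ε₂ ε₃ ε₄ : ℤ) →
    IsUnit ε₁ → IsUnit ε₂ → IsUnit ε₃ → IsUnit ε₄ →
    height s (i , j) ≡ k →
    height s (i , j - 1ℤ) ≡ k + ε₁ →
    height s (i , j + 1ℤ) ≡ k + ε₂ →
    height s (i - 1ℤ , j) ≡ k + ε₃ →
    height s (i + 1ℤ , j) ≡ k + ε₄ →
    (y s (i , j) ≈
       ((I i j (k - 1ℤ) · (J i (j - 1ℤ) k ^ pos ε₁) · (J i (j + 1ℤ) k ^ pos ε₂))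
        ÷ (J i j (k - 1ℤ) · (I (i - 1ℤ) j k ^ pos ε₃) · (I (i + 1ℤ) j k ^ pos ε₄))))
    × (y s (i , j) ≈
       ((J i j (k + 1ℤ) · (I (i - 1ℤ) j k ^ pos (- ε₃)) · (I (i + 1ℤ) j k ^ pos (- ε₄)))
        ÷ (I i j (k + 1ℤ) · (J i (j - 1ℤ) k ^ pos (- ε₁)) · (J i (j + 1ℤ) k ^ pos (- ε₂)))))
proposition3p3 s reachable i j k ε₁ ε₂ ε₃ ε₄ u₁ u₂ u₃ u₄ h₀ h₁ h₂ h₃ h₄ =
  below , λ p → trans (below p) (yBelow≈yAbove i j k u₁ u₂ u₃ u₄ p)
  where
  difference : ∀ {a ε} → a ≡ k + ε → a - height s (i , j) ≡ ε
  difference {ε = ε} a≡ = trans (cong₂ _-_ a≡ h₀) (add-sub k ε)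
    where add-sub : ∀ k ε → (k + ε) - k ≡ ε
          add-sub = solve-∀

  below : y s (i , j) ≈ yBelow i j k ε₁ ε₂ ε₃ ε₄
  below p = trans (Invariant.y≈coefficient (reachable-invariant reachable) (i , j) p)
                  (yBelow-cong i j h₀ (difference h₁) (difference h₂) (difference h₃) (difference h₄) p)
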